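{- Let $1\le k\le n-1$ be integers. The $h^*$-polynomial of the matroid polytope $\mathscr{P}(T_{k,n})$ of the minimal matroid $T_{k,n}$ is \[h^*(T_{k,n},x) = \sum_{j=0}^{k-1} \binom{k-1}{j}\binom{n-k-1}{j} x^j. \] Moreover, its coefficient vector (the $h^*$-vector) is log-concave and hence unimodal.
   Context: For integers $1\le k\le n-1$, $T_{k,n}$ denotes the cycle matroid of the graph obtained from a cycle of length $k+1$ by replacing one of its edges with $n-k$ parallel edges (a connected matroid of rank $k$ on $n$ elements). For a matroid $M$ on $\{1,\dots,n\}$, its matroid polytope is $\mathscr{P}(M)=\operatorname{conv}\{\sum_{i\in B}e_i : B \text{ a basis of } M\}\subseteq\mathbb{R}^n$. For a lattice polytope $\mathscr{P}$ of dimension $d$ with Ehrhart polynomial $i(\mathscr{P},t)=\#(t\mathscr{P}\cap\mathbb{Z}^n)$, the $h^*$-polynomial is the polynomial $h^*(x)$ with $\sum_{t\ge0} i(\mathscr{P},t)x^t = h^*(x)/(1-x)^{d+1}$; here $\mathscr{P}(T_{k,n})$ has dimension $n-1$. A sequence $(a_j)$ is log-concave if $a_j^2\ge a_{j-1}a_{j+1}$ for all $j$. -}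

module Defs where

open import Data.Nat as ℕ using (ℕ; zero; suc; _<?_)
open import Data.Nat.Combinatorics using (_C_)
open import Data.Fin as Fin using (Fin; toℕ; fromℕ; fromℕ<; inject₁)
open import Data.Fin.Subset using (Subset; _∈_; ∣_∣)
open import Data.Fin.Subset.Properties using (_∈?_)
open import Data.Integer as ℤ using (ℤ; +_)
open import Data.Rational as ℚ using (ℚ; 0ℚ; 1ℚ)
open import Data.Vec using (Vec; lookup)
open import Data.List using (List; length; foldr)
open import Data.List.Relation.Unary.All using (All)
open import Data.List.Relation.Unary.Unique.Propositional using (Unique)
open import Data.List.Membership.Propositional renaming (_∈_ to _∈ˡ_)
open import Data.Product using (Σ; _×_; _,_; ∃; proj₁; proj₂)
open import Relation.Nullary using (yes; no)
open import Relation.Binary.PropositionalEquality using (_≡_)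
open import Function.Bundles using (_⇔_)

record Multigraph : Set where
  field
    nV    : ℕ
    nE    : ℕ
    ends  : Fin nE → Fin nV × Fin nV

module _ (G : Multigraph) where
  open Multigraph G

  data Conn (S : Subset nE) : Fin nV → Fin nV → Set where
    here : ∀ {v} → Conn S v v
    fwd  : ∀ {w} e → e ∈ S → Conn S (proj₂ (ends e)) w → Conn S (proj₁ (ends e)) w
    bwd  : ∀ {w} e → e ∈ S → Conn S (proj₁ (ends e)) w → Conn S (proj₂ (ends e)) w

  IsSpanningTree : Subset nE → Set
  IsSpanningTree S = (∀ u v → Conn S u v) × (suc ∣ S ∣ ≡ nV)

  -- Bases of the cycle matroid M(G) of a connected graph G = spanning trees.
  IsCycleBasis : Subset nE → Set
  IsCycleBasis = IsSpanningTree

-- The graph of T_{k,n}: a cycle on vertices 0..k (edges i -- i+1 for i<k,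
-- and the closing edge k -- 0), where the closing edge is replaced by
-- n-k parallel edges.  Edges 0..k-1 are the path edges, edges k..n-1
-- are the parallel edges.

TGraph : ℕ → ℕ → Multigraph
TGraph k n = record { nV = suc k ; nE = n ; ends = e }
  where
  e : Fin n → Fin (suc k) × Fin (suc k)
  e x with toℕ x <? k
  ... | yes p = inject₁ (fromℕ< p) , Fin.suc (fromℕ< p)
  ... | no _  = fromℕ k , Fin.zero

IsBasisT : (k n : ℕ) → Subset n → Set
IsBasisT k n = IsCycleBasis (TGraph k n)

indicator : ∀ {n} → Subset n → Fin n → ℚ
indicator B i with i ∈? B
... | yes _ = 1ℚ
... | no _  = 0ℚ

WSum : ∀ {n} → List (ℚ × Subset n) → (Fin n → ℚ)
WSum L i = foldr (λ p acc → proj₁ p ℚ.* indicator (proj₂ p) i ℚ.+ acc) 0ℚ L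

weightSum : ∀ {n} → List (ℚ × Subset n) → ℚ
weightSum L = foldr (λ p acc → proj₁ p ℚ.+ acc) 0ℚ L

-- x ∈ t · P(M), where M has basis predicate IsB and
-- P(M) = conv { e_B : B basis }  (convex combinations with rational weights)
InDilate : ∀ {n} → (Subset n → Set) → ℕ → Vec ℤ n → Set
InDilate {n} IsB t x =
  Σ (List (ℚ × Subset n)) λ L →
    All (λ p → (0ℚ ℚ.≤ proj₁ p) × IsB (proj₂ p)) L
    × weightSum L ≡ 1ℚ
    × (∀ i → (lookup x i ℚ./ 1) ≡ ((+ t) ℚ./ 1) ℚ.* WSum L i)

LatticeCount : ∀ {n} → (Subset n → Set) → ℕ → ℕ → Set
LatticeCount {n} IsB t N =
  Σ (List (Vec ℤ n)) λ pts →
    Unique pts × (∀ x → (x ∈ˡ pts) ⇔ InDilate IsB t x) × length pts ≡ N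

IsEhrhart : ∀ {n} → (Subset n → Set) → (ℕ → ℕ) → Set
IsEhrhart IsB i = ∀ t → LatticeCount IsB t (i t)

Series : Set
Series = ℕ → ℤ

sumTo : ℕ → (ℕ → ℤ) → ℤ
sumTo zero    f = f 0
sumTo (suc m) f = sumTo m f ℤ.+ f (suc m)

_⊛_ : Series → Series → Series
(f ⊛ g) m = sumTo m (λ j → f j ℤ.* g (m ℕ.∸ j))

oneSeries : Series
oneSeries zero = + 1
oneSeries (suc _) = + 0

oneMinusX : Series
oneMinusX zero = + 1
oneMinusX (suc zero) = ℤ.- (+ 1)
oneMinusX (suc (suc _)) = + 0

oneMinusXPow : ℕ → Series
oneMinusXPow zero = oneSeries
oneMinusXPow (suc d) = oneMinusX ⊛ oneMinusXPow d

-- h is the h*-vector of a d-dimensional polytope with Ehrhart function i: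
-- Σ_t i(t) x^t = h(x) / (1-x)^{d+1}, i.e. (1-x)^{d+1} Σ_t i(t) x^t = h(x).
IsHStar : (d : ℕ) → (ℕ → ℕ) → (ℕ → ℕ) → Set
IsHStar d i h = ∀ m → (oneMinusXPow (suc d) ⊛ (λ t → + i t)) m ≡ + h m

LogConcave : (ℕ → ℕ) → Set
LogConcave a = ∀ j → a j ℕ.* a (suc (suc j)) ℕ.≤ a (suc j) ℕ.* a (suc j)

Unimodal : (ℕ → ℕ) → Set
Unimodal a = ∃ λ m → (∀ i j → i ℕ.≤ j → j ℕ.≤ m → a i ℕ.≤ a j)
                   × (∀ i j → m ℕ.≤ i → i ℕ.≤ j → a j ℕ.≤ a i)

hT : ℕ → ℕ → ℕ → ℕ
hT k n j = ((k ℕ.∸ 1) C j) ℕ.* ((n ℕ.∸ k ℕ.∸ 1) C j)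

module Submission where

-- A basis of T_{k,n} is a spanning tree of a (k+1)-cycle whose closing edge is replaced by n-k
-- parallel edges: either all k path edges, or all path edges but one together with one parallel
-- edge. So every basis indicator has k ones and at most one of them on a parallel edge, and the
-- lattice points of t·P(T_{k,n}) are exactly the vectors (t - d, y) with d ∈ ℕ^k, y ∈ ℕ^(n-k)
-- and |d| = |y| ≤ t: convexity gives 0 ≤ x ≤ t, Σ x = k t and Σ_parallel x ≤ t, and conversely
-- such a point is peeled, one basis indicator at a time, down to the origin. Counting
-- compositions, i(t) = Σ_{s ≤ t} C(s+k-1, k-1) C(s+n-k-1, n-k-1), and Pascal's rule in both
-- factors gives (1 - x)^n Σ_t i(t) x^t = Σ_j C(k-1, j) C(n-k-1, j) x^j. Each binomial row is
-- log-concave (by the absorption identity) without internal zeros, hence so is their product,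
-- and such a sequence is unimodal.

open import Defs
open import Data.Nat using (ℕ)

module ConvolutionAlgebra where

  open import Data.Nat as ℕ using (ℕ; zero; suc; z≤n)
  import Data.Nat.Properties as ℕP
  open import Data.Integer using (ℤ; +_; _+_; _*_; -_; _-_)
  import Data.Integer.Properties as ℤP
  open import Data.Integer.Tactic.RingSolver using (solve-∀)
  open import Relation.Binary.PropositionalEquality

  infix 4 _≈ₛ_
  _≈ₛ_ : Series → Series → Set
  f ≈ₛ g = ∀ m → f m ≡ g m

  sumTo-cong≤ : ∀ m {f g : ℕ → ℤ} → (∀ j → j ℕ.≤ m → f j ≡ g j) → sumTo m f ≡ sumTo m g
  sumTo-cong≤ zero    f≡g = f≡g 0 z≤n
  sumTo-cong≤ (suc m) f≡g =
    cong₂ _+_ (sumTo-cong≤ m (λ j j≤m → f≡g j (ℕP.m≤n⇒m≤1+n j≤m))) (f≡g (suc m) ℕP.≤-refl)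

  sumTo-cong : ∀ m {f g : ℕ → ℤ} → (∀ j → f j ≡ g j) → sumTo m f ≡ sumTo m g
  sumTo-cong m f≡g = sumTo-cong≤ m (λ j _ → f≡g j)

  sumTo-suc : ∀ m (f : ℕ → ℤ) → sumTo (suc m) f ≡ f 0 + sumTo m (λ j → f (suc j))
  sumTo-suc zero    f = refl
  sumTo-suc (suc m) f = trans (cong (_+ f (suc (suc m))) (sumTo-suc m f))
    (ℤP.+-assoc (f 0) (sumTo m (λ j → f (suc j))) (f (suc (suc m))))

  sumTo-+ : ∀ m (f g : ℕ → ℤ) → sumTo m (λ j → f j + g j) ≡ sumTo m f + sumTo m g
  sumTo-+ zero    f g = refl
  sumTo-+ (suc m) f g = trans (cong (_+ (f (suc m) + g (suc m))) (sumTo-+ m f g))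
    (interchange (sumTo m f) (sumTo m g) (f (suc m)) (g (suc m)))
    where
    interchange : ∀ a b c d → (a + b) + (c + d) ≡ (a + c) + (b + d)
    interchange = solve-∀

  sumTo-*ˡ : ∀ m c (f : ℕ → ℤ) → sumTo m (λ j → c * f j) ≡ c * sumTo m f
  sumTo-*ˡ zero    c f = refl
  sumTo-*ˡ (suc m) c f = trans (cong (_+ (c * f (suc m))) (sumTo-*ˡ m c f))
    (sym (ℤP.*-distribˡ-+ c (sumTo m f) (f (suc m))))

  sumTo-zero : ∀ m → sumTo m (λ _ → + 0) ≡ + 0
  sumTo-zero zero    = refl
  sumTo-zero (suc m) = cong (_+ + 0) (sumTo-zero m)

  shift : Series → Series
  shift f j = f (suc j)

  ⊛-sucˡ : ∀ f g m → (f ⊛ g) (suc m) ≡ f 0 * g (suc m) + (shift f ⊛ g) m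
  ⊛-sucˡ f g m = sumTo-suc m (λ j → f j * g (suc m ℕ.∸ j))

  ⊛-sucʳ : ∀ f g m → (f ⊛ g) (suc m) ≡ (f ⊛ shift g) m + f (suc m) * g 0
  ⊛-sucʳ f g m = cong₂ _+_
    (sumTo-cong≤ m (λ j j≤m → cong (λ z → f j * g z) (ℕP.+-∸-assoc 1 j≤m)))
    (cong (λ z → f (suc m) * g z) (ℕP.n∸n≡0 m))

  ⊛-cong : ∀ {f f′ g g′} → f ≈ₛ f′ → g ≈ₛ g′ → f ⊛ g ≈ₛ f′ ⊛ g′
  ⊛-cong f≈ g≈ m = sumTo-cong m (λ j → cong₂ _*_ (f≈ j) (g≈ (m ℕ.∸ j)))

  ⊛-congʳ : ∀ f {g g′} → g ≈ₛ g′ → f ⊛ g ≈ₛ f ⊛ g′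
  ⊛-congʳ f = ⊛-cong {f = f} (λ _ → refl)

  ⊛-congˡ : ∀ {f f′} g → f ≈ₛ f′ → f ⊛ g ≈ₛ f′ ⊛ g
  ⊛-congˡ g f≈ = ⊛-cong {g = g} f≈ (λ _ → refl)

  ⊛-comm : ∀ f g → f ⊛ g ≈ₛ g ⊛ f
  ⊛-comm f g zero    = ℤP.*-comm (f 0) (g 0)
  ⊛-comm f g (suc m) = begin
    (f ⊛ g) (suc m)                   ≡⟨ ⊛-sucˡ f g m ⟩
    f 0 * g (suc m) + (shift f ⊛ g) m ≡⟨ cong (_+_ (f 0 * g (suc m))) (⊛-comm (shift f) g m) ⟩
    f 0 * g (suc m) + (g ⊛ shift f) m ≡⟨ swap (f 0) (g (suc m)) ((g ⊛ shift f) m) ⟩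
    (g ⊛ shift f) m + g (suc m) * f 0 ≡⟨ sym (⊛-sucʳ g f m) ⟩
    (g ⊛ f) (suc m)                   ∎
    where
    open ≡-Reasoning
    swap : ∀ a b c → a * b + c ≡ c + b * a
    swap = solve-∀

  ⊛-distribʳ-+ : ∀ f g h → (λ j → f j + g j) ⊛ h ≈ₛ (λ m → (f ⊛ h) m + (g ⊛ h) m)
  ⊛-distribʳ-+ f g h m =
    trans (sumTo-cong m (λ j → ℤP.*-distribʳ-+ (h (m ℕ.∸ j)) (f j) (g j))) (sumTo-+ m _ _)

  ⊛-distribˡ-+ : ∀ f g h → f ⊛ (λ j → g j + h j) ≈ₛ (λ m → (f ⊛ g) m + (f ⊛ h) m)
  ⊛-distribˡ-+ f g h m =
    trans (sumTo-cong m (λ j → ℤP.*-distribˡ-+ (f j) (g (m ℕ.∸ j)) (h (m ℕ.∸ j)))) (sumTo-+ m _ _)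

  ⊛-*ˡ : ∀ c f h → (λ j → c * f j) ⊛ h ≈ₛ (λ m → c * (f ⊛ h) m)
  ⊛-*ˡ c f h m = trans (sumTo-cong m (λ j → ℤP.*-assoc c (f j) (h (m ℕ.∸ j)))) (sumTo-*ˡ m c _)

  ⊛-negʳ : ∀ f g → f ⊛ (λ j → - g j) ≈ₛ (λ m → - (f ⊛ g) m)
  ⊛-negʳ f g m = begin
    sumTo m (λ j → f j * - g (m ℕ.∸ j))        ≡⟨ sumTo-cong m (λ j → neg-as-scaling (f j) (g (m ℕ.∸ j))) ⟩
    sumTo m (λ j → - + 1 * (f j * g (m ℕ.∸ j))) ≡⟨ sumTo-*ˡ m (- + 1) _ ⟩
    - + 1 * (f ⊛ g) m                           ≡⟨ ℤP.neg-distribˡ-* (+ 1) ((f ⊛ g) m) ⟨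
    - (+ 1 * (f ⊛ g) m)                         ≡⟨ cong -_ (ℤP.*-identityˡ ((f ⊛ g) m)) ⟩
    - (f ⊛ g) m                                 ∎
    where
    open ≡-Reasoning
    neg-as-scaling : ∀ a b → a * - b ≡ - + 1 * (a * b)
    neg-as-scaling = solve-∀

  ⊛-distribˡ-+- : ∀ f g h k → f ⊛ (λ j → (g j + h j) - k j) ≈ₛ (λ m → ((f ⊛ g) m + (f ⊛ h) m) - (f ⊛ k) m)
  ⊛-distribˡ-+- f g h k m =
    trans (⊛-distribˡ-+ f (λ j → g j + h j) (λ j → - k j) m)
          (cong₂ _+_ (⊛-distribˡ-+ f g h m) (⊛-negʳ f k m))

  ⊛-assoc : ∀ f g h → (f ⊛ g) ⊛ h ≈ₛ f ⊛ (g ⊛ h)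
  ⊛-assoc f g h zero    = ℤP.*-assoc (f 0) (g 0) (h 0)
  ⊛-assoc f g h (suc m) = begin
    ((f ⊛ g) ⊛ h) (suc m)                                          ≡⟨ ⊛-sucˡ (f ⊛ g) h m ⟩
    (f 0 * g 0) * h (suc m) + (shift (f ⊛ g) ⊛ h) m                ≡⟨ cong (_+_ ((f 0 * g 0) * h (suc m))) shifted ⟩
    (f 0 * g 0) * h (suc m) + (f 0 * (shift g ⊛ h) m + (shift f ⊛ (g ⊛ h)) m)
      ≡⟨ regroup (f 0) (g 0) (h (suc m)) ((shift g ⊛ h) m) ((shift f ⊛ (g ⊛ h)) m) ⟩
    f 0 * (g 0 * h (suc m) + (shift g ⊛ h) m) + (shift f ⊛ (g ⊛ h)) m
      ≡⟨ cong (λ z → f 0 * z + (shift f ⊛ (g ⊛ h)) m) (⊛-sucˡ g h m) ⟨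
    f 0 * (g ⊛ h) (suc m) + (shift f ⊛ (g ⊛ h)) m                   ≡⟨ ⊛-sucˡ f (g ⊛ h) m ⟨
    (f ⊛ (g ⊛ h)) (suc m)                                          ∎
    where
    open ≡-Reasoning
    regroup : ∀ a b c d e → (a * b) * c + (a * d + e) ≡ a * (b * c + d) + e
    regroup = solve-∀
    shifted : (shift (f ⊛ g) ⊛ h) m ≡ f 0 * (shift g ⊛ h) m + (shift f ⊛ (g ⊛ h)) m
    shifted = begin
      (shift (f ⊛ g) ⊛ h) m
        ≡⟨ ⊛-congˡ h (⊛-sucˡ f g) m ⟩
      ((λ j → f 0 * g (suc j) + (shift f ⊛ g) j) ⊛ h) m
        ≡⟨ ⊛-distribʳ-+ (λ j → f 0 * g (suc j)) (shift f ⊛ g) h m ⟩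
      ((λ j → f 0 * g (suc j)) ⊛ h) m + ((shift f ⊛ g) ⊛ h) m
        ≡⟨ cong₂ _+_ (⊛-*ˡ (f 0) (shift g) h m) (⊛-assoc (shift f) g h m) ⟩
      f 0 * (shift g ⊛ h) m + (shift f ⊛ (g ⊛ h)) m ∎

  ⊛-concentrated : ∀ u f → (∀ j → u (suc j) ≡ + 0) → u ⊛ f ≈ₛ (λ m → u 0 * f m)
  ⊛-concentrated u f u≡0 zero    = refl
  ⊛-concentrated u f u≡0 (suc m) = begin
    (u ⊛ f) (suc m)                                 ≡⟨ ⊛-sucˡ u f m ⟩
    u 0 * f (suc m) + sumTo m (λ j → u (suc j) * f (m ℕ.∸ j))
      ≡⟨ cong (_+_ (u 0 * f (suc m))) (sumTo-cong m (λ j → cong (_* f (m ℕ.∸ j)) (u≡0 j))) ⟩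
    u 0 * f (suc m) + sumTo m (λ _ → + 0)           ≡⟨ cong (_+_ (u 0 * f (suc m))) (sumTo-zero m) ⟩
    u 0 * f (suc m) + + 0                           ≡⟨ ℤP.+-identityʳ _ ⟩
    u 0 * f (suc m)                                 ∎
    where open ≡-Reasoning

  oneSeries-⊛ : ∀ f → oneSeries ⊛ f ≈ₛ f
  oneSeries-⊛ f m = trans (⊛-concentrated oneSeries f (λ _ → refl) m) (ℤP.*-identityˡ (f m))

  oneMinusX-⊛-zero : ∀ f → (oneMinusX ⊛ f) 0 ≡ f 0
  oneMinusX-⊛-zero f = ℤP.*-identityˡ (f 0)

  oneMinusX-⊛-suc : ∀ f m → (oneMinusX ⊛ f) (suc m) ≡ f (suc m) - f m
  oneMinusX-⊛-suc f m = begin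
    (oneMinusX ⊛ f) (suc m)                    ≡⟨ ⊛-sucˡ oneMinusX f m ⟩
    + 1 * f (suc m) + (shift oneMinusX ⊛ f) m  ≡⟨ cong (_+_ (+ 1 * f (suc m))) (⊛-concentrated (shift oneMinusX) f (λ _ → refl) m) ⟩
    + 1 * f (suc m) + - + 1 * f m              ≡⟨ difference (f (suc m)) (f m) ⟩
    f (suc m) - f m                            ∎
    where
    open ≡-Reasoning
    difference : ∀ a b → + 1 * a + - + 1 * b ≡ a - b
    difference = solve-∀

  oneMinusXPow-cong : ∀ {p q} → p ≡ q → ∀ f → oneMinusXPow p ⊛ f ≈ₛ oneMinusXPow q ⊛ f
  oneMinusXPow-cong refl f m = refl

  oneMinusXPow-suc-⊛ : ∀ d f → oneMinusXPow (suc d) ⊛ f ≈ₛ oneMinusXPow d ⊛ (oneMinusX ⊛ f)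
  oneMinusXPow-suc-⊛ d f m = begin
    ((oneMinusX ⊛ oneMinusXPow d) ⊛ f) m ≡⟨ ⊛-congˡ f (⊛-comm oneMinusX (oneMinusXPow d)) m ⟩
    ((oneMinusXPow d ⊛ oneMinusX) ⊛ f) m ≡⟨ ⊛-assoc (oneMinusXPow d) oneMinusX f m ⟩
    (oneMinusXPow d ⊛ (oneMinusX ⊛ f)) m ∎
    where open ≡-Reasoning

module HStarSeries where

  open ConvolutionAlgebra
  open import Data.Nat as ℕ using (ℕ; zero; suc)
  import Data.Nat.Properties as ℕP
  open import Data.Integer using (ℤ; +_; _+_; _*_; -_; _-_)
  import Data.Integer.Properties as ℤP
  open import Data.Integer.Tactic.RingSolver using (solve-∀)
  open import Relation.Binary.PropositionalEquality

  -- compositionCount a s = C(s + a, a), the number of compositions of s into a + 1 parts.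
  compositionCount : ℕ → ℕ → ℕ
  compositionCount zero    s       = 1
  compositionCount (suc a) zero    = 1
  compositionCount (suc a) (suc s) = compositionCount a (suc s) ℕ.+ compositionCount (suc a) s

  compositionCount-zero : ∀ a → compositionCount a 0 ≡ 1
  compositionCount-zero zero    = refl
  compositionCount-zero (suc a) = refl

  binomial : ℕ → ℕ → ℕ
  binomial n       zero    = 1
  binomial zero    (suc k) = 0
  binomial (suc n) (suc k) = binomial n k ℕ.+ binomial n (suc k)

  compositionSeries : ℕ → Series
  compositionSeries b s = + compositionCount b s

  productSeries : ℕ → ℕ → Series
  productSeries a b s = + compositionCount a s * + compositionCount b s

  binomialProductSeries : ℕ → ℕ → Series
  binomialProductSeries a b j = + binomial a j * + binomial b j

  oneMinusX-⊛-compositionSeries : ∀ b → oneMinusX ⊛ compositionSeries (suc b) ≈ₛ compositionSeries b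
  oneMinusX-⊛-compositionSeries b zero    =
    trans (oneMinusX-⊛-zero (compositionSeries (suc b))) (cong +_ (sym (compositionCount-zero b)))
  oneMinusX-⊛-compositionSeries b (suc s) =
    trans (oneMinusX-⊛-suc (compositionSeries (suc b)) s)
          (cancel (+ compositionCount b (suc s)) (+ compositionCount (suc b) s))
    where
    cancel : ∀ x y → (x + y) - y ≡ x
    cancel = solve-∀

  oneMinusXPow-⊛-compositionSeries : ∀ b → oneMinusXPow (suc b) ⊛ compositionSeries b ≈ₛ oneSeries
  oneMinusXPow-⊛-compositionSeries b m = begin
    (oneMinusXPow (suc b) ⊛ compositionSeries b) m         ≡⟨ oneMinusXPow-suc-⊛ b (compositionSeries b) m ⟩
    (oneMinusXPow b ⊛ (oneMinusX ⊛ compositionSeries b)) m ≡⟨ peel b m ⟩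
    oneSeries m                                            ∎
    where
    open ≡-Reasoning
    differenceOfOnes : oneMinusX ⊛ compositionSeries 0 ≈ₛ oneSeries
    differenceOfOnes zero    = refl
    differenceOfOnes (suc m) = oneMinusX-⊛-suc (compositionSeries 0) m
    peel : ∀ b → oneMinusXPow b ⊛ (oneMinusX ⊛ compositionSeries b) ≈ₛ oneSeries
    peel zero    m = trans (oneSeries-⊛ (oneMinusX ⊛ compositionSeries 0) m) (differenceOfOnes m)
    peel (suc b) m = trans (⊛-congʳ (oneMinusXPow (suc b)) (oneMinusX-⊛-compositionSeries b) m)
                           (oneMinusXPow-⊛-compositionSeries b m)

  -- Pascal's rule in both factors; the solver applies directly since + (m ℕ.+ n) is definitionally + m + + n.
  oneMinusX-⊛-productSeries : ∀ a b →
    oneMinusX ⊛ productSeries (suc a) (suc b) ≈ₛ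
    (λ s → (productSeries a (suc b) s + productSeries (suc a) b s) - productSeries a b s)
  oneMinusX-⊛-productSeries a b zero
    rewrite compositionCount-zero a | compositionCount-zero b = refl
  oneMinusX-⊛-productSeries a b (suc s) =
    trans (oneMinusX-⊛-suc (productSeries (suc a) (suc b)) s)
          (identity (+ compositionCount a (suc s)) (+ compositionCount (suc a) s)
                    (+ compositionCount b (suc s)) (+ compositionCount (suc b) s))
    where
    identity : ∀ A A′ B B′ → (A + A′) * (B + B′) - A′ * B′ ≡ (A * (B + B′) + (A + A′) * B) - A * B
    identity = solve-∀

  binomialProductSeries-pascal : ∀ a b →
    binomialProductSeries (suc a) (suc b) ≈ₛ
    (λ j → (binomialProductSeries a (suc b) j + binomialProductSeries (suc a) b j)
             - (oneMinusX ⊛ binomialProductSeries a b) j)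
  binomialProductSeries-pascal a b zero =
    sym (cong (λ z → (binomialProductSeries a (suc b) 0 + binomialProductSeries (suc a) b 0) - z)
              (oneMinusX-⊛-zero (binomialProductSeries a b)))
  binomialProductSeries-pascal a b (suc j) =
    sym (trans (cong (λ z → (binomialProductSeries a (suc b) (suc j) + binomialProductSeries (suc a) b (suc j)) - z)
                     (oneMinusX-⊛-suc (binomialProductSeries a b) j))
               (identity (+ binomial a j) (+ binomial a (suc j)) (+ binomial b j) (+ binomial b (suc j))))
    where
    identity : ∀ α α′ β β′ → (α′ * (β + β′) + (α + α′) * β′) - (α′ * β′ - α * β) ≡ (α + α′) * (β + β′)
    identity = solve-∀

  oneMinusXPow-⊛-productSeries : ∀ a b →
    oneMinusXPow (suc (a ℕ.+ b)) ⊛ productSeries a b ≈ₛ binomialProductSeries a b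
  oneMinusXPow-⊛-productSeries zero b m =
    trans (⊛-congʳ (oneMinusXPow (suc b)) (λ s → ℤP.*-identityˡ (compositionSeries b s)) m)
          (trans (oneMinusXPow-⊛-compositionSeries b m) (onlyConstantTerm m))
    where
    onlyConstantTerm : oneSeries ≈ₛ binomialProductSeries 0 b
    onlyConstantTerm zero    = refl
    onlyConstantTerm (suc m) = refl
  oneMinusXPow-⊛-productSeries (suc a) zero m =
    trans (oneMinusXPow-cong (cong suc (ℕP.+-identityʳ (suc a))) (productSeries (suc a) 0) m)
    (trans (⊛-congʳ (oneMinusXPow (suc (suc a))) (λ s → ℤP.*-identityʳ (compositionSeries (suc a) s)) m)
    (trans (oneMinusXPow-⊛-compositionSeries (suc a) m) (onlyConstantTerm m)))
    where
    onlyConstantTerm : oneSeries ≈ₛ binomialProductSeries (suc a) 0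
    onlyConstantTerm zero    = refl
    onlyConstantTerm (suc m) = sym (ℤP.*-zeroʳ (+ binomial (suc a) (suc m)))
  oneMinusXPow-⊛-productSeries (suc a) (suc b) m = begin
    (oneMinusXPow (suc D) ⊛ productSeries (suc a) (suc b)) m
      ≡⟨ oneMinusXPow-suc-⊛ D (productSeries (suc a) (suc b)) m ⟩
    (P ⊛ (oneMinusX ⊛ productSeries (suc a) (suc b))) m
      ≡⟨ ⊛-congʳ P (oneMinusX-⊛-productSeries a b) m ⟩
    (P ⊛ (λ s → (productSeries a (suc b) s + productSeries (suc a) b s) - productSeries a b s)) m
      ≡⟨ ⊛-distribˡ-+- P (productSeries a (suc b)) (productSeries (suc a) b) (productSeries a b) m ⟩
    ((P ⊛ productSeries a (suc b)) m + (P ⊛ productSeries (suc a) b) m) - (P ⊛ productSeries a b) m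
      ≡⟨ cong₂ (λ x y → (x + y) - (P ⊛ productSeries a b) m)
               (oneMinusXPow-⊛-productSeries a (suc b) m)
               (trans (oneMinusXPow-cong D≡ (productSeries (suc a) b) m) (oneMinusXPow-⊛-productSeries (suc a) b m)) ⟩
    (binomialProductSeries a (suc b) m + binomialProductSeries (suc a) b m) - (P ⊛ productSeries a b) m
      ≡⟨ cong (λ z → (binomialProductSeries a (suc b) m + binomialProductSeries (suc a) b m) - z) lowerTerm ⟩
    (binomialProductSeries a (suc b) m + binomialProductSeries (suc a) b m) - (oneMinusX ⊛ binomialProductSeries a b) m
      ≡⟨ binomialProductSeries-pascal a b m ⟨
    binomialProductSeries (suc a) (suc b) m ∎
    where
    open ≡-Reasoning
    D : ℕ
    D = suc (a ℕ.+ suc b)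
    P : Series
    P = oneMinusXPow D
    D≡ : D ≡ suc (suc a ℕ.+ b)
    D≡ = cong suc (ℕP.+-suc a b)
    lowerTerm : (P ⊛ productSeries a b) m ≡ (oneMinusX ⊛ binomialProductSeries a b) m
    lowerTerm = begin
      (P ⊛ productSeries a b) m
        ≡⟨ oneMinusXPow-cong D≡ (productSeries a b) m ⟩
      ((oneMinusX ⊛ oneMinusXPow (suc (a ℕ.+ b))) ⊛ productSeries a b) m
        ≡⟨ ⊛-assoc oneMinusX (oneMinusXPow (suc (a ℕ.+ b))) (productSeries a b) m ⟩
      (oneMinusX ⊛ (oneMinusXPow (suc (a ℕ.+ b)) ⊛ productSeries a b)) m
        ≡⟨ ⊛-congʳ oneMinusX (oneMinusXPow-⊛-productSeries a b) m ⟩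
      (oneMinusX ⊛ binomialProductSeries a b) m ∎

  cumulativeCount : ℕ → ℕ → ℕ → ℕ
  cumulativeCount a b zero    = compositionCount a 0 ℕ.* compositionCount b 0
  cumulativeCount a b (suc t) = cumulativeCount a b t ℕ.+ compositionCount a (suc t) ℕ.* compositionCount b (suc t)

  oneMinusX-⊛-cumulativeCount : ∀ a b → oneMinusX ⊛ (λ t → + cumulativeCount a b t) ≈ₛ productSeries a b
  oneMinusX-⊛-cumulativeCount a b zero    =
    trans (oneMinusX-⊛-zero (λ t → + cumulativeCount a b t)) (ℤP.pos-* (compositionCount a 0) (compositionCount b 0))
  oneMinusX-⊛-cumulativeCount a b (suc t) = begin
    (oneMinusX ⊛ C) (suc t)         ≡⟨ oneMinusX-⊛-suc C t ⟩
    (C t + + new) - C t             ≡⟨ cancel (C t) (+ new) ⟩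
    + new                           ≡⟨ ℤP.pos-* (compositionCount a (suc t)) (compositionCount b (suc t)) ⟩
    productSeries a b (suc t)       ∎
    where
    open ≡-Reasoning
    C : Series
    C t = + cumulativeCount a b t
    new : ℕ
    new = compositionCount a (suc t) ℕ.* compositionCount b (suc t)
    cancel : ∀ x y → (x + y) - x ≡ y
    cancel = solve-∀

  oneMinusXPow-⊛-cumulativeCount : ∀ a b →
    oneMinusXPow (suc a ℕ.+ suc b) ⊛ (λ t → + cumulativeCount a b t) ≈ₛ binomialProductSeries a b
  oneMinusXPow-⊛-cumulativeCount a b m = begin
    (oneMinusXPow (suc a ℕ.+ suc b) ⊛ C) m            ≡⟨ oneMinusXPow-cong (cong suc (ℕP.+-suc a b)) C m ⟩
    (oneMinusXPow (suc (suc (a ℕ.+ b))) ⊛ C) m        ≡⟨ oneMinusXPow-suc-⊛ (suc (a ℕ.+ b)) C m ⟩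
    (oneMinusXPow (suc (a ℕ.+ b)) ⊛ (oneMinusX ⊛ C)) m ≡⟨ ⊛-congʳ (oneMinusXPow (suc (a ℕ.+ b))) (oneMinusX-⊛-cumulativeCount a b) m ⟩
    (oneMinusXPow (suc (a ℕ.+ b)) ⊛ productSeries a b) m ≡⟨ oneMinusXPow-⊛-productSeries a b m ⟩
    binomialProductSeries a b m                        ∎
    where
    open ≡-Reasoning
    C : Series
    C t = + cumulativeCount a b t

module LogConcavity where

  open HStarSeries using (binomial)
  open import Data.Nat
  open import Data.Nat.Properties
  import Data.Nat.Tactic.RingSolver as ℕSolver
  open import Data.Product using (_,_)
  open import Data.Sum using (inj₁; inj₂)
  open import Relation.Binary.PropositionalEquality
  open import Relation.Nullary using (yes; no)

  -- (j + 1) C(a, j + 1) = (a - j) C(a, j), stated without subtraction.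
  binomial-absorption : ∀ a j → suc j * binomial a (suc j) + j * binomial a j ≡ a * binomial a j
  binomial-absorption zero    zero    = refl
  binomial-absorption zero    (suc j) = cong₂ _+_ (*-zeroʳ (suc (suc j))) (*-zeroʳ (suc j))
  binomial-absorption (suc a) zero    = begin
    1 * (1 + x₁) + 0 * 1 ≡⟨ tidy x₁ ⟩
    suc x₁               ≡⟨ cong suc (trans (tidy′ x₁) (binomial-absorption a 0)) ⟩
    suc (a * 1)          ∎
    where
    open ≡-Reasoning
    x₁ : ℕ
    x₁ = binomial a 1
    tidy : ∀ x → 1 * (1 + x) + 0 * 1 ≡ suc x
    tidy = ℕSolver.solve-∀
    tidy′ : ∀ x → x ≡ 1 * x + 0 * 1
    tidy′ = ℕSolver.solve-∀
  binomial-absorption (suc a) (suc j) = begin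
    suc (suc j) * (x₁ + x₂) + suc j * (x₀ + x₁)                    ≡⟨ regroup₁ j x₀ x₁ x₂ ⟩
    suc (suc j) * x₁ + (suc (suc j) * x₂ + suc j * x₁) + suc j * x₀
      ≡⟨ cong (λ z → suc (suc j) * x₁ + z + suc j * x₀) (binomial-absorption a (suc j)) ⟩
    suc (suc j) * x₁ + a * x₁ + suc j * x₀                         ≡⟨ regroup₂ j a x₀ x₁ ⟩
    x₀ + x₁ + (suc j * x₁ + j * x₀) + a * x₁                       ≡⟨ cong (λ z → x₀ + x₁ + z + a * x₁) (binomial-absorption a j) ⟩
    x₀ + x₁ + a * x₀ + a * x₁                                      ≡⟨ regroup₃ a x₀ x₁ ⟩
    suc a * (x₀ + x₁)                                              ∎
    where
    open ≡-Reasoning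
    x₀ x₁ x₂ : ℕ
    x₀ = binomial a j
    x₁ = binomial a (suc j)
    x₂ = binomial a (suc (suc j))
    regroup₁ : ∀ j x₀ x₁ x₂ → suc (suc j) * (x₁ + x₂) + suc j * (x₀ + x₁)
               ≡ suc (suc j) * x₁ + (suc (suc j) * x₂ + suc j * x₁) + suc j * x₀
    regroup₁ = ℕSolver.solve-∀
    regroup₂ : ∀ j a x₀ x₁ → suc (suc j) * x₁ + a * x₁ + suc j * x₀ ≡ x₀ + x₁ + (suc j * x₁ + j * x₀) + a * x₁
    regroup₂ = ℕSolver.solve-∀
    regroup₃ : ∀ a x₀ x₁ → x₀ + x₁ + a * x₀ + a * x₁ ≡ suc a * (x₀ + x₁)
    regroup₃ = ℕSolver.solve-∀

  -- Absorption twice gives (j+1)(j+2) C(a,j+1)² = (j+1)(j+2) C(a,j) C(a,j+2) + (a+1) C(a,j) C(a,j+1).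
  binomial-logConcave : ∀ a → LogConcave (binomial a)
  binomial-logConcave a j = *-cancelˡ-≤ K (subst (K * (x * z) ≤_) (sym identity) (m≤m+n _ _))
    where
    open ≡-Reasoning
    x y z K : ℕ
    x = binomial a j
    y = binomial a (suc j)
    z = binomial a (suc (suc j))
    K = suc j * suc (suc j)
    step₁ : ∀ j x y → (suc j * suc (suc j)) * (y * y) + j * suc (suc j) * (x * y)
            ≡ suc (suc j) * y * (suc j * y + j * x)
    step₁ = ℕSolver.solve-∀
    step₂ : ∀ j a x y → suc (suc j) * y * (a * x) ≡ suc j * x * (a * y) + a * x * y
    step₂ = ℕSolver.solve-∀
    step₃ : ∀ j a x y z → suc j * x * (suc (suc j) * z + suc j * y) + a * x * y
            ≡ (suc j * suc (suc j)) * (x * z) + (1 + a) * (x * y) + j * suc (suc j) * (x * y)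
    step₃ = ℕSolver.solve-∀
    identityWithSurplus : K * (y * y) + j * suc (suc j) * (x * y)
                        ≡ (K * (x * z) + (1 + a) * (x * y)) + j * suc (suc j) * (x * y)
    identityWithSurplus = begin
      K * (y * y) + j * suc (suc j) * (x * y)          ≡⟨ step₁ j x y ⟩
      suc (suc j) * y * (suc j * y + j * x)            ≡⟨ cong (λ w → suc (suc j) * y * w) (binomial-absorption a j) ⟩
      suc (suc j) * y * (a * x)                        ≡⟨ step₂ j a x y ⟩
      suc j * x * (a * y) + a * x * y                  ≡⟨ cong (λ w → suc j * x * w + a * x * y) (binomial-absorption a (suc j)) ⟨
      suc j * x * (suc (suc j) * z + suc j * y) + a * x * y ≡⟨ step₃ j a x y z ⟩
      (K * (x * z) + (1 + a) * (x * y)) + j * suc (suc j) * (x * y) ∎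
    identity : K * (y * y) ≡ K * (x * z) + (1 + a) * (x * y)
    identity = +-cancelʳ-≡ _ _ _ identityWithSurplus

  LogConcave-* : ∀ {f g} → LogConcave f → LogConcave g → LogConcave (λ j → f j * g j)
  LogConcave-* {f} {g} lcf lcg j = begin
    (f j * g j) * (f (2 + j) * g (2 + j))                ≡⟨ interchange (f j) (g j) (f (2 + j)) (g (2 + j)) ⟩
    (f j * f (2 + j)) * (g j * g (2 + j))                ≤⟨ *-mono-≤ (lcf j) (lcg j) ⟩
    (f (1 + j) * f (1 + j)) * (g (1 + j) * g (1 + j))    ≡⟨ interchange (f (1 + j)) (f (1 + j)) (g (1 + j)) (g (1 + j)) ⟩
    (f (1 + j) * g (1 + j)) * (f (1 + j) * g (1 + j))    ∎
    where
    open ≤-Reasoning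
    interchange : ∀ p q r s → (p * q) * (r * s) ≡ (p * r) * (q * s)
    interchange = ℕSolver.solve-∀

  NoInternalZeros : (ℕ → ℕ) → Set
  NoInternalZeros h = ∀ j → h j ≡ 0 → h (suc j) ≡ 0

  binomial-noInternalZeros : ∀ a → NoInternalZeros (binomial a)
  binomial-noInternalZeros zero    zero    ()
  binomial-noInternalZeros zero    (suc j) _ = refl
  binomial-noInternalZeros (suc a) zero    ()
  binomial-noInternalZeros (suc a) (suc j) e = cong₂ _+_
    (binomial-noInternalZeros a j (m+n≡0⇒m≡0 _ e))
    (binomial-noInternalZeros a (suc j) (m+n≡0⇒n≡0 (binomial a j) e))

  binomial-vanishesAbove : ∀ a → binomial a (suc a) ≡ 0
  binomial-vanishesAbove zero    = refl
  binomial-vanishesAbove (suc a) =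
    cong₂ _+_ (binomial-vanishesAbove a) (binomial-noInternalZeros a (suc a) (binomial-vanishesAbove a))

  NoInternalZeros-* : ∀ {f g} → NoInternalZeros f → NoInternalZeros g → NoInternalZeros (λ j → f j * g j)
  NoInternalZeros-* {f} {g} nzf nzg j e with m*n≡0⇒m≡0∨n≡0 (f j) e
  ... | inj₁ fj≡0 = cong (_* g (suc j)) (nzf j fj≡0)
  ... | inj₂ gj≡0 = trans (cong (f (suc j) *_) (nzg j gj≡0)) (*-zeroʳ (f (suc j)))

  module _ {h : ℕ → ℕ} (lc : LogConcave h) (nz : NoInternalZeros h) where

    descent-propagates : ∀ l → h (suc l) ≤ h l → h (2 + l) ≤ h (suc l)
    descent-propagates l le with h l in eq
    ... | zero  = ≤-reflexive (trans (nz (suc l) (n≤0⇒n≡0 le)) (sym (n≤0⇒n≡0 le)))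
    ... | suc c = *-cancelˡ-≤ (suc c) (begin
        suc c * h (2 + l)       ≡⟨ cong (_* h (2 + l)) eq ⟨
        h l * h (2 + l)         ≤⟨ lc l ⟩
        h (suc l) * h (suc l)   ≤⟨ *-monoʳ-≤ (h (suc l)) le ⟩
        h (suc l) * suc c       ≡⟨ *-comm (h (suc l)) (suc c) ⟩
        suc c * h (suc l)       ∎)
      where open ≤-Reasoning

    descent-beyond : ∀ m → h (suc m) ≤ h m → ∀ j → m ≤ j → h (suc j) ≤ h j
    descent-beyond m dm zero    z≤n = dm
    descent-beyond m dm (suc j) m≤1+j with m≤n⇒m<n∨m≡n m≤1+j
    ... | inj₂ refl = dm
    ... | inj₁ m<1+j = descent-propagates j (descent-beyond m dm j (≤-pred m<1+j))

    nonincreasing-from : ∀ m → h (suc m) ≤ h m → ∀ i j → m ≤ i → i ≤ j → h j ≤ h i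
    nonincreasing-from m dm i zero    m≤i z≤n = ≤-refl
    nonincreasing-from m dm i (suc j) m≤i i≤1+j with m≤n⇒m<n∨m≡n i≤1+j
    ... | inj₂ refl = ≤-refl
    ... | inj₁ i<1+j = ≤-trans (descent-beyond m dm j (≤-trans m≤i (≤-pred i<1+j)))
                               (nonincreasing-from m dm i j m≤i (≤-pred i<1+j))

    nondecreasing-to : ∀ m → (∀ j → j < m → h j ≤ h (suc j)) → ∀ i j → i ≤ j → j ≤ m → h i ≤ h j
    nondecreasing-to m up i zero    z≤n _ = ≤-refl
    nondecreasing-to m up i (suc j) i≤1+j 1+j≤m with m≤n⇒m<n∨m≡n i≤1+j
    ... | inj₂ refl = ≤-refl
    ... | inj₁ i<1+j = ≤-trans (nondecreasing-to m up i j (≤-pred i<1+j) (<⇒≤ 1+j≤m)) (up j 1+j≤m)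

    data FirstDescent (N : ℕ) : Set where
      ascending : (∀ j → j < N → h j ≤ h (suc j)) → FirstDescent N
      descent   : ∀ m → (∀ j → j < m → h j ≤ h (suc j)) → h (suc m) ≤ h m → FirstDescent N

    firstDescent : ∀ N → FirstDescent N
    firstDescent zero = ascending (λ j ())
    firstDescent (suc N) with firstDescent N
    ... | descent m up dm = descent m up dm
    ... | ascending up with h N ≤? h (suc N)
    ...   | no  hN≰ = descent N up (<⇒≤ (≰⇒> hN≰))
    ...   | yes hN≤ = ascending extend
      where
      extend : ∀ j → j < suc N → h j ≤ h (suc j)
      extend j j<1+N with m≤n⇒m<n∨m≡n (≤-pred j<1+N)
      ... | inj₁ j<N  = up j j<N
      ... | inj₂ refl = hN≤

    logConcave⇒unimodal : ∀ N → h (suc N) ≤ h N → Unimodal h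
    logConcave⇒unimodal N dN with firstDescent N
    ... | descent m up dm = m , nondecreasing-to m up , nonincreasing-from m dm
    ... | ascending up    = N , nondecreasing-to N up , nonincreasing-from N dN

module SpanningTrees where

  open import Data.Nat as ℕ using (ℕ; zero; suc; z≤n; s≤s; _<?_; _≤?_)
  import Data.Nat.Properties as ℕP
  open import Data.Fin as Fin using (Fin; toℕ; fromℕ; fromℕ<; inject₁; _↑ˡ_; _↑ʳ_)
  import Data.Fin.Properties as FP
  open import Data.Fin.Subset using (Subset; _∈_; _∉_; ∣_∣; ⊤; ⊥; ⁅_⁆; ∁; inside; outside)
  open import Data.Fin.Subset.Properties
    using (∈⊤; ∉⊥; x∈⁅x⁆; x∈⁅y⁆⇒x≡y; x≢y⇒x∉⁅y⁆; x∉p⇒x∈∁p; x∈∁p⇒x∉p; ∣⊤∣≡n; ∣⊥∣≡0; ∣⁅x⁆∣≡1; ∣∁p∣≡n∸∣p∣)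
  open import Data.Bool using (Bool; true; false; _∧_)
  open import Data.Vec using ([]; _∷_; _++_; here; there)
  open import Data.Product using (_×_; _,_; proj₁; proj₂; Σ; ∃)
  open import Data.Empty using (⊥-elim)
  open import Data.Sum using (inj₁; inj₂)
  open import Relation.Binary.PropositionalEquality
  open import Relation.Nullary using (yes; no; ¬_; does)
  open import Relation.Nullary.Negation using (contradiction)
  open import Relation.Nullary.Decidable using (dec-true; dec-false)
  open import Data.Bool.Properties using (∧-zeroʳ)

  module _ (G : Multigraph) where
    open Multigraph G

    Conn-trans : ∀ {S u v w} → Conn G S u v → Conn G S v w → Conn G S u w
    Conn-trans here        c = c
    Conn-trans (fwd e p c) d = fwd e p (Conn-trans c d)
    Conn-trans (bwd e p c) d = bwd e p (Conn-trans c d)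

    Conn-sym : ∀ {S u v} → Conn G S u v → Conn G S v u
    Conn-sym here        = here
    Conn-sym (fwd e p c) = Conn-trans (Conn-sym c) (bwd e p here)
    Conn-sym (bwd e p c) = Conn-trans (Conn-sym c) (fwd e p here)

    Conn-invariant : ∀ {A : Set} (f : Fin nV → A) {S} →
      (∀ e → e ∈ S → f (proj₁ (ends e)) ≡ f (proj₂ (ends e))) →
      ∀ {u v} → Conn G S u v → f u ≡ f v
    Conn-invariant f edge here        = refl
    Conn-invariant f edge (fwd e p c) = trans (edge e p) (Conn-invariant f edge c)
    Conn-invariant f edge (bwd e p c) = trans (sym (edge e p)) (Conn-invariant f edge c)

    spanning-via : ∀ {S} r → (∀ v → Conn G S v r) → ∀ u v → Conn G S u v
    spanning-via r toRoot u v = Conn-trans (toRoot u) (Conn-sym (toRoot v))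

  ∣p++q∣ : ∀ {m n} (p : Subset m) (q : Subset n) → ∣ p ++ q ∣ ≡ ∣ p ∣ ℕ.+ ∣ q ∣
  ∣p++q∣ []            q = refl
  ∣p++q∣ (inside  ∷ p) q = cong suc (∣p++q∣ p q)
  ∣p++q∣ (outside ∷ p) q = ∣p++q∣ p q

  x∈p⇒x↑ˡ∈p++q : ∀ {m n} {p : Subset m} {q : Subset n} {i} → i ∈ p → (i ↑ˡ n) ∈ (p ++ q)
  x∈p⇒x↑ˡ∈p++q here      = here
  x∈p⇒x↑ˡ∈p++q (there x) = there (x∈p⇒x↑ˡ∈p++q x)

  x∈q⇒m↑ʳx∈p++q : ∀ {m n} (p : Subset m) {q : Subset n} {j} → j ∈ q → (m ↑ʳ j) ∈ (p ++ q)
  x∈q⇒m↑ʳx∈p++q []      j∈q = j∈q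
  x∈q⇒m↑ʳx∈p++q (_ ∷ p) j∈q = there (x∈q⇒m↑ʳx∈p++q p j∈q)

  x↑ˡ∈p++q⇒x∈p : ∀ {m n} (p : Subset m) {q : Subset n} {i} → (i ↑ˡ n) ∈ (p ++ q) → i ∈ p
  x↑ˡ∈p++q⇒x∈p (_ ∷ p) {i = Fin.zero}  here      = here
  x↑ˡ∈p++q⇒x∈p (_ ∷ p) {i = Fin.suc i} (there x) = there (x↑ˡ∈p++q⇒x∈p p x)

  m↑ʳx∈p++q⇒x∈q : ∀ {m n} (p : Subset m) {q : Subset n} {j} → (m ↑ʳ j) ∈ (p ++ q) → j ∈ q
  m↑ʳx∈p++q⇒x∈q []      j∈ = j∈
  m↑ʳx∈p++q⇒x∈q (_ ∷ p) (there j∈) = m↑ʳx∈p++q⇒x∈q p j∈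

  ∉-witness : ∀ {n} (p : Subset n) → suc ∣ p ∣ ℕ.≤ n → ∃ λ i → i ∉ p
  ∉-witness (outside ∷ p) _ = Fin.zero , λ ()
  ∉-witness (inside  ∷ p) (s≤s le) with ∉-witness p le
  ... | i , i∉p = Fin.suc i , λ { (there i∈p) → i∉p i∈p }

  two-∉-witnesses : ∀ {n} (p : Subset n) → suc (suc ∣ p ∣) ℕ.≤ n →
    Σ (Fin n) λ i₁ → Σ (Fin n) λ i₂ → toℕ i₁ ℕ.< toℕ i₂ × i₁ ∉ p × i₂ ∉ p
  two-∉-witnesses (outside ∷ p) (s≤s le) with ∉-witness p le
  ... | i , i∉p = Fin.zero , Fin.suc i , s≤s z≤n , (λ ()) , λ { (there i∈p) → i∉p i∈p }
  two-∉-witnesses (inside  ∷ p) (s≤s le) with two-∉-witnesses p le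
  ... | i₁ , i₂ , i₁<i₂ , i₁∉p , i₂∉p =
    Fin.suc i₁ , Fin.suc i₂ , s≤s i₁<i₂ , (λ { (there x) → i₁∉p x }) , λ { (there x) → i₂∉p x }

  module TBases (K M : ℕ) where

    G : Multigraph
    G = TGraph K (K ℕ.+ M)

    open Multigraph G

    IsBasis : Subset (K ℕ.+ M) → Set
    IsBasis = IsBasisT K (K ℕ.+ M)

    data EdgeView : Fin (K ℕ.+ M) → Set where
      path     : ∀ l → EdgeView (l ↑ˡ M)
      parallel : ∀ j → EdgeView (K ↑ʳ j)

    edgeView : ∀ e → EdgeView e
    edgeView e with Fin.splitAt K e | FP.join-splitAt K M e
    ... | inj₁ l | refl = path l
    ... | inj₂ j | refl = parallel j

    ends-path : ∀ l → ends (l ↑ˡ M) ≡ (inject₁ l , Fin.suc l)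
    ends-path l with toℕ (l ↑ˡ M) <? K
    ... | yes p = cong₂ _,_ (cong inject₁ fromℕ<≡l) (cong Fin.suc fromℕ<≡l)
      where
      fromℕ<≡l : fromℕ< p ≡ l
      fromℕ<≡l = FP.toℕ-injective (trans (FP.toℕ-fromℕ< p) (FP.toℕ-↑ˡ l M))
    ... | no ¬p = contradiction (subst (ℕ._< K) (sym (FP.toℕ-↑ˡ l M)) (FP.toℕ<n l)) ¬p

    ends-parallel : ∀ j → ends (K ↑ʳ j) ≡ (fromℕ K , Fin.zero)
    ends-parallel j with toℕ (K ↑ʳ j) <? K
    ... | yes p = contradiction (subst (ℕ._< K) (FP.toℕ-↑ʳ K j) p) (ℕP.≤⇒≯ (ℕP.m≤m+n K (toℕ j)))
    ... | no _  = refl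

    step-down : ∀ {S} l → (l ↑ˡ M) ∈ S → Conn G S (Fin.suc l) (inject₁ l)
    step-down {S} l p =
      subst₂ (Conn G S) (cong proj₂ (ends-path l)) (cong proj₁ (ends-path l)) (bwd (l ↑ˡ M) p here)

    step-parallel : ∀ {S} j → (K ↑ʳ j) ∈ S → Conn G S (fromℕ K) Fin.zero
    step-parallel {S} j p =
      subst₂ (Conn G S) (cong proj₁ (ends-parallel j)) (cong proj₂ (ends-parallel j)) (fwd (K ↑ʳ j) p here)

    descend : ∀ {S} n (b v : Fin (suc K)) → toℕ v ≡ n → toℕ b ℕ.≤ n →
      (∀ l → toℕ b ℕ.≤ toℕ l → toℕ l ℕ.< n → (l ↑ˡ M) ∈ S) → Conn G S v b
    descend {S} zero b Fin.zero _ b≤0 _ =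
      subst (Conn G S Fin.zero) (FP.toℕ-injective (sym (ℕP.n≤0⇒n≡0 b≤0))) here
    descend {S} (suc n) b (Fin.suc l) v≡ b≤ edges with toℕ b ℕ.≟ suc n
    ... | yes b≡ = subst (Conn G S (Fin.suc l)) (FP.toℕ-injective (trans v≡ (sym b≡))) here
    ... | no  b≢ = Conn-trans G (step-down l (edges l b≤l (ℕP.≤-reflexive v≡)))
                     (descend n b (inject₁ l) (trans (FP.toℕ-inject₁ l) l≡n) b≤n
                        (λ l′ b≤l′ l′<n → edges l′ b≤l′ (ℕP.m<n⇒m<1+n l′<n)))
      where
      l≡n : toℕ l ≡ n
      l≡n = ℕP.suc-injective v≡
      b≤n : toℕ b ℕ.≤ n
      b≤n = ℕP.≤-pred (ℕP.≤∧≢⇒< b≤ b≢)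
      b≤l : toℕ b ℕ.≤ toℕ l
      b≤l = subst (toℕ b ℕ.≤_) (sym l≡n) b≤n

    pathBasis : Subset (K ℕ.+ M)
    pathBasis = ⊤ {K} ++ ⊥ {M}

    exchangeBasis : Fin K → Fin M → Subset (K ℕ.+ M)
    exchangeBasis i j = ∁ ⁅ i ⁆ ++ ⁅ j ⁆

    pathBasis-path : ∀ l → (l ↑ˡ M) ∈ pathBasis
    pathBasis-path l = x∈p⇒x↑ˡ∈p++q {p = ⊤} {q = ⊥} ∈⊤

    pathBasis-parallel : ∀ j → (K ↑ʳ j) ∉ pathBasis
    pathBasis-parallel j j∈ = ∉⊥ (m↑ʳx∈p++q⇒x∈q (⊤ {K}) j∈)

    exchangeBasis-path : ∀ {i j} l → l ≢ i → (l ↑ˡ M) ∈ exchangeBasis i j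
    exchangeBasis-path l l≢i = x∈p⇒x↑ˡ∈p++q (x∉p⇒x∈∁p (x≢y⇒x∉⁅y⁆ l≢i))

    exchangeBasis-removed : ∀ i j → (i ↑ˡ M) ∉ exchangeBasis i j
    exchangeBasis-removed i j i∈ = x∈∁p⇒x∉p (x↑ˡ∈p++q⇒x∈p (∁ ⁅ i ⁆) i∈) (x∈⁅x⁆ i)

    exchangeBasis-added : ∀ i j → (K ↑ʳ j) ∈ exchangeBasis i j
    exchangeBasis-added i j = x∈q⇒m↑ʳx∈p++q (∁ ⁅ i ⁆) (x∈⁅x⁆ j)

    exchangeBasis-parallel : ∀ {i j} j′ → j′ ≢ j → (K ↑ʳ j′) ∉ exchangeBasis i j
    exchangeBasis-parallel {i} j′ j′≢j j′∈ = j′≢j (x∈⁅y⁆⇒x≡y _ (m↑ʳx∈p++q⇒x∈q (∁ ⁅ i ⁆) j′∈))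

    pathBasis-isBasis : IsBasis pathBasis
    pathBasis-isBasis =
      spanning-via G Fin.zero (λ v → descend (toℕ v) Fin.zero v refl z≤n (λ l _ _ → pathBasis-path l)) ,
      cong suc (begin
        ∣ ⊤ {K} ++ ⊥ {M} ∣      ≡⟨ ∣p++q∣ (⊤ {K}) (⊥ {M}) ⟩
        ∣ ⊤ {K} ∣ ℕ.+ ∣ ⊥ {M} ∣ ≡⟨ cong₂ ℕ._+_ (∣⊤∣≡n K) (∣⊥∣≡0 M) ⟩
        K ℕ.+ 0                 ≡⟨ ℕP.+-identityʳ K ⟩
        K                       ∎)
      where open ≡-Reasoning

    exchangeBasis-isBasis : ∀ i j → IsBasis (exchangeBasis i j)
    exchangeBasis-isBasis i j = spanning-via G Fin.zero reach , cong suc size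
      where
      open ≡-Reasoning
      kept : ∀ l → toℕ l ≢ toℕ i → (l ↑ˡ M) ∈ exchangeBasis i j
      kept l l≢i = exchangeBasis-path l (λ l≡i → l≢i (cong toℕ l≡i))
      aboveI : ∀ (v : Fin (suc K)) → toℕ i ℕ.< toℕ v → Conn G (exchangeBasis i j) v (Fin.suc i)
      aboveI v i<v = descend (toℕ v) (Fin.suc i) v refl i<v
                       (λ l i<l _ → kept l (λ l≡i → ℕP.<-irrefl (sym l≡i) i<l))
      reach : ∀ v → Conn G (exchangeBasis i j) v Fin.zero
      reach v with toℕ v ℕ.≤? toℕ i
      ... | yes v≤i = descend (toℕ v) Fin.zero v refl z≤n
                        (λ l _ l<v → kept l (λ l≡i → ℕP.<-irrefl l≡i (ℕP.<-≤-trans l<v v≤i)))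
      ... | no  v≰i = Conn-trans G (aboveI v (ℕP.≰⇒> v≰i))
                        (Conn-trans G (Conn-sym G (aboveI (fromℕ K) i<K))
                                      (step-parallel j (x∈q⇒m↑ʳx∈p++q (∁ ⁅ i ⁆) (x∈⁅x⁆ j))))
        where
        i<K : toℕ i ℕ.< toℕ (fromℕ K)
        i<K = subst (toℕ i ℕ.<_) (sym (FP.toℕ-fromℕ K)) (FP.toℕ<n i)
      size : ∣ exchangeBasis i j ∣ ≡ K
      size = begin
        ∣ ∁ ⁅ i ⁆ ++ ⁅ j ⁆ ∣         ≡⟨ ∣p++q∣ (∁ ⁅ i ⁆) ⁅ j ⁆ ⟩
        ∣ ∁ ⁅ i ⁆ ∣ ℕ.+ ∣ ⁅ j ⁆ ∣     ≡⟨ cong₂ ℕ._+_ (∣∁p∣≡n∸∣p∣ ⁅ i ⁆) (∣⁅x⁆∣≡1 j) ⟩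
        (K ℕ.∸ ∣ ⁅ i ⁆ ∣) ℕ.+ 1        ≡⟨ cong (λ c → (K ℕ.∸ c) ℕ.+ 1) (∣⁅x⁆∣≡1 i) ⟩
        (K ℕ.∸ 1) ℕ.+ 1               ≡⟨ ℕP.m∸n+n≡m (ℕP.≤-trans (s≤s z≤n) (FP.toℕ<n i)) ⟩
        K                             ∎

    between : ℕ → ℕ → ℕ → Bool
    between x y v = does (x <? v) ∧ does (v ≤? y)

    between-suc : ∀ {x y v} → v ≢ x → v ≢ y → between x y (suc v) ≡ between x y v
    between-suc {x} {y} {v} v≢x v≢y = cong₂ _∧_ lower upper
      where
      lower : does (x <? suc v) ≡ does (x <? v)
      lower with x <? v
      ... | yes x<v = trans (dec-true (x <? suc v) (ℕP.m<n⇒m<1+n x<v)) (sym (dec-true (x <? v) x<v))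
      ... | no  x≮v = trans (dec-false (x <? suc v) x≮1+v) (sym (dec-false (x <? v) x≮v))
        where
        x≮1+v : ¬ x ℕ.< suc v
        x≮1+v x<1+v = x≮v (ℕP.≤∧≢⇒< (ℕP.≤-pred x<1+v) (λ x≡v → v≢x (sym x≡v)))
      upper : does (suc v ≤? y) ≡ does (v ≤? y)
      upper with v ≤? y
      ... | yes v≤y = trans (dec-true (suc v ≤? y) (ℕP.≤∧≢⇒< v≤y v≢y)) (sym (dec-true (v ≤? y) v≤y))
      ... | no  v≰y = trans (dec-false (suc v ≤? y) (λ 1+v≤y → v≰y (ℕP.<⇒≤ 1+v≤y))) (sym (dec-false (v ≤? y) v≰y))

    -- The vertices i₁ + 1, …, i₂ of the arc between two missing path edges i₁ < i₂ are cut off: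
    -- membership in that arc is constant along every remaining edge.
    two-missing-path-edges-disconnect : ∀ (Sp : Subset K) (Sq : Subset M) {i₁ i₂} →
      toℕ i₁ ℕ.< toℕ i₂ → i₁ ∉ Sp → i₂ ∉ Sp → ¬ Conn G (Sp ++ Sq) Fin.zero (Fin.suc i₁)
    two-missing-path-edges-disconnect Sp Sq {i₁} {i₂} i₁<i₂ i₁∉ i₂∉ conn =
      false≢true (trans (sym arc-origin) (trans (Conn-invariant G inArc invariant conn) arc-start))
      where
      false≢true : false ≢ true
      false≢true ()
      inArc : Fin (suc K) → Bool
      inArc v = between (toℕ i₁) (toℕ i₂) (toℕ v)
      arc-origin : inArc Fin.zero ≡ false
      arc-origin = cong (_∧ does (0 ≤? toℕ i₂)) (dec-false (toℕ i₁ <? 0) λ ())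
      arc-start : inArc (Fin.suc i₁) ≡ true
      arc-start = cong₂ _∧_ (dec-true (toℕ i₁ <? suc (toℕ i₁)) ℕP.≤-refl) (dec-true (suc (toℕ i₁) ≤? toℕ i₂) i₁<i₂)
      arc-top : inArc (fromℕ K) ≡ false
      arc-top = trans (cong (does (toℕ i₁ <? toℕ (fromℕ K)) ∧_)
                        (dec-false (toℕ (fromℕ K) ≤? toℕ i₂)
                          (ℕP.<⇒≱ (subst (toℕ i₂ ℕ.<_) (sym (FP.toℕ-fromℕ K)) (FP.toℕ<n i₂)))))
                      (∧-zeroʳ _)
      invariant : ∀ e → e ∈ (Sp ++ Sq) → inArc (proj₁ (ends e)) ≡ inArc (proj₂ (ends e))
      invariant e e∈S with edgeView e
      ... | parallel j rewrite ends-parallel j = arc-top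
      ... | path l rewrite ends-path l | FP.toℕ-inject₁ l = sym (between-suc (missing i₁∉) (missing i₂∉))
        where
        missing : ∀ {i} → i ∉ Sp → toℕ l ≢ toℕ i
        missing i∉ l≡i = i∉ (subst (_∈ Sp) (FP.toℕ-injective l≡i) (x↑ˡ∈p++q⇒x∈p Sp e∈S))

    atMostOneParallel : ∀ (Sp : Subset K) (Sq : Subset M) → IsBasis (Sp ++ Sq) → ∣ Sq ∣ ℕ.≤ 1
    atMostOneParallel Sp Sq (conn , card) with ∣ Sq ∣ ℕ.≤? 1
    ... | yes ≤1 = ≤1
    ... | no  ≰1 with two-∉-witnesses Sp fewPathEdges
      where
      fewPathEdges : suc (suc ∣ Sp ∣) ℕ.≤ K
      fewPathEdges = subst (suc (suc ∣ Sp ∣) ℕ.≤_)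
        (trans (sym (∣p++q∣ Sp Sq)) (ℕP.suc-injective card))
        (ℕP.≤-trans (ℕP.≤-reflexive (ℕP.+-comm 2 ∣ Sp ∣)) (ℕP.+-monoʳ-≤ ∣ Sp ∣ (ℕP.≰⇒> ≰1)))
    ... | i₁ , i₂ , i₁<i₂ , i₁∉ , i₂∉ =
      ⊥-elim (two-missing-path-edges-disconnect Sp Sq i₁<i₂ i₁∉ i₂∉ (conn Fin.zero (Fin.suc i₁)))

module Compositions where

  open HStarSeries using (compositionCount)
  open import Data.Nat as ℕ using (ℕ; zero; suc)
  import Data.Nat.Properties as ℕP
  open import Data.Vec as V using (Vec; []; _∷_; replicate; sum; lookup)
  import Data.Vec.Properties as VP
  open import Data.List using (List; length; map; cartesianProductWith) renaming ([] to nil; _∷_ to cons; _++_ to _++ˡ_)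
  import Data.List.Properties as LP
  open import Data.List.Membership.Propositional using (_∈_)
  open import Data.List.Membership.Propositional.Properties
  open import Data.List.Relation.Unary.Any using (here)
  open import Data.List.Relation.Unary.Unique.Propositional using (Unique)
  import Data.List.Relation.Unary.Unique.Propositional.Properties as Unique
  import Data.List.Relation.Unary.AllPairs as AllPairs
  import Data.List.Relation.Unary.All as All
  open import Data.Product using (_×_; _,_; ∃)
  open import Data.Fin as Fin using (Fin)
  open import Data.Sum using (inj₁; inj₂)
  open import Relation.Binary.PropositionalEquality
  open import Relation.Nullary using (¬_)

  incrementHead : ∀ {n} → Vec ℕ (suc n) → Vec ℕ (suc n)
  incrementHead (x ∷ v) = suc x ∷ v

  compositions : (a s : ℕ) → List (Vec ℕ (suc a))
  compositions zero    s       = cons (s ∷ []) nil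
  compositions (suc a) zero    = cons (replicate (suc (suc a)) 0) nil
  compositions (suc a) (suc s) =
    map (0 ∷_) (compositions a (suc s)) ++ˡ map incrementHead (compositions (suc a) s)

  length-compositions : ∀ a s → length (compositions a s) ≡ compositionCount a s
  length-compositions zero    s       = refl
  length-compositions (suc a) zero    = refl
  length-compositions (suc a) (suc s) =
    trans (LP.length-++ (map (0 ∷_) (compositions a (suc s))))
          (cong₂ ℕ._+_ (trans (LP.length-map _ (compositions a (suc s))) (length-compositions a (suc s)))
                       (trans (LP.length-map _ (compositions (suc a) s)) (length-compositions (suc a) s)))

  sum≡0⇒replicate0 : ∀ {n} (v : Vec ℕ n) → sum v ≡ 0 → v ≡ replicate n 0
  sum≡0⇒replicate0 []          _  = refl
  sum≡0⇒replicate0 (zero ∷ v)  e  = cong (0 ∷_) (sum≡0⇒replicate0 v e)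

  map-injective : ∀ {A B : Set} {f : A → B} {n} → (∀ {x y} → f x ≡ f y → x ≡ y) →
    ∀ {xs ys : Vec A n} → V.map f xs ≡ V.map f ys → xs ≡ ys
  map-injective f-inj {[]}     {[]}     _  = refl
  map-injective f-inj {x ∷ xs} {y ∷ ys} eq =
    cong₂ _∷_ (f-inj (VP.∷-injectiveˡ eq)) (map-injective f-inj (VP.∷-injectiveʳ eq))

  lookup-ext : ∀ {A : Set} {n} {xs ys : Vec A n} → (∀ i → lookup xs i ≡ lookup ys i) → xs ≡ ys
  lookup-ext {xs = xs} {ys} eq =
    trans (sym (VP.tabulate∘lookup xs)) (trans (VP.tabulate-cong eq) (VP.tabulate∘lookup ys))

  zero-entries : ∀ {n} (v : Vec ℕ n) → V.sum v ≡ 0 → ∀ i → lookup v i ≡ 0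
  zero-entries v sum≡0 i = trans (cong (λ w → lookup w i) (sum≡0⇒replicate0 v sum≡0)) (VP.lookup-replicate i 0)

  positive-entry : ∀ {n} (v : Vec ℕ n) {s} → V.sum v ≡ suc s → ∃ λ i → ∃ λ c → lookup v i ≡ suc c
  positive-entry (zero  ∷ v) e with positive-entry v e
  ... | i , c , vᵢ≡ = Fin.suc i , c , vᵢ≡
  positive-entry (suc x ∷ v) e = Fin.zero , x , refl

  decrement : ∀ {n} → Vec ℕ n → Fin n → Vec ℕ n
  decrement v i = V.updateAt v i ℕ.pred

  sum-decrement : ∀ {n} (v : Vec ℕ n) i {c} → lookup v i ≡ suc c → suc (V.sum (decrement v i)) ≡ V.sum v
  sum-decrement (x ∷ v) Fin.zero    refl = refl
  sum-decrement (x ∷ v) (Fin.suc i) vᵢ≡  =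
    trans (sym (ℕP.+-suc x (V.sum (decrement v i)))) (cong (x ℕ.+_) (sum-decrement v i vᵢ≡))

  sum-replicate0 : ∀ n → sum (replicate n 0) ≡ 0
  sum-replicate0 zero    = refl
  sum-replicate0 (suc n) = sum-replicate0 n

  ∈-compositions⁻ : ∀ a s v → v ∈ compositions a s → sum v ≡ s
  ∈-compositions⁻ zero    s       (x ∷ []) (here refl) = ℕP.+-identityʳ s
  ∈-compositions⁻ (suc a) zero    v        (here refl) = sum-replicate0 (suc (suc a))
  ∈-compositions⁻ (suc a) (suc s) v        v∈ with ∈-++⁻ (map (0 ∷_) (compositions a (suc s))) v∈
  ... | inj₁ v∈₀ with ∈-map⁻ (0 ∷_) v∈₀
  ...   | w , w∈ , refl = ∈-compositions⁻ a (suc s) w w∈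
  ∈-compositions⁻ (suc a) (suc s) v v∈ | inj₂ v∈₊ with ∈-map⁻ incrementHead v∈₊
  ...   | (x ∷ w) , w∈ , refl = cong suc (∈-compositions⁻ (suc a) s (x ∷ w) w∈)

  ∈-compositions⁺ : ∀ a s v → sum v ≡ s → v ∈ compositions a s
  ∈-compositions⁺ zero    s       (x ∷ [])    e = here (cong (_∷ []) (trans (sym (ℕP.+-identityʳ x)) e))
  ∈-compositions⁺ (suc a) zero    v           e = here (sum≡0⇒replicate0 v e)
  ∈-compositions⁺ (suc a) (suc s) (zero ∷ w)  e =
    ∈-++⁺ˡ (∈-map⁺ (0 ∷_) (∈-compositions⁺ a (suc s) w e))
  ∈-compositions⁺ (suc a) (suc s) (suc x ∷ w) e =
    ∈-++⁺ʳ (map (0 ∷_) (compositions a (suc s)))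
           (∈-map⁺ incrementHead (∈-compositions⁺ (suc a) s (x ∷ w) (ℕP.suc-injective e)))

  compositions-unique : ∀ a s → Unique (compositions a s)
  compositions-unique zero    s       = All.[] AllPairs.∷ AllPairs.[]
  compositions-unique (suc a) zero    = All.[] AllPairs.∷ AllPairs.[]
  compositions-unique (suc a) (suc s) = Unique.++⁺
    (Unique.map⁺ VP.∷-injectiveʳ (compositions-unique a (suc s)))
    (Unique.map⁺ incrementHead-injective (compositions-unique (suc a) s))
    disjoint
    where
    incrementHead-injective : ∀ {v w : Vec ℕ (suc (suc a))} → incrementHead v ≡ incrementHead w → v ≡ w
    incrementHead-injective {x ∷ v} {y ∷ w} e = cong₂ _∷_ (ℕP.suc-injective (VP.∷-injectiveˡ e)) (VP.∷-injectiveʳ e)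
    disjoint : ∀ {v} → ¬ (v ∈ map (0 ∷_) (compositions a (suc s)) × v ∈ map incrementHead (compositions (suc a) s))
    disjoint (p , q) with ∈-map⁻ (0 ∷_) p | ∈-map⁻ incrementHead q
    ... | w , _ , refl | (x ∷ w′) , _ , ()

  length-cartesianProductWith : ∀ {A B C : Set} (f : A → B → C) (xs : List A) (ys : List B) →
    length (cartesianProductWith f xs ys) ≡ length xs ℕ.* length ys
  length-cartesianProductWith f nil         ys = refl
  length-cartesianProductWith f (cons x xs) ys = trans (LP.length-++ (map (f x) ys))
    (cong₂ ℕ._+_ (LP.length-map (f x) ys) (length-cartesianProductWith f xs ys))

module Dilates where

  open import Data.Nat as ℕ using (ℕ; zero; suc; z≤n; s≤s)
  open import Data.Integer as ℤ using (ℤ; +_)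
  import Data.Integer.Properties as ℤP
  open import Data.Integer.Tactic.RingSolver using (solve-∀)
  open import Data.Rational as ℚ using (ℚ; 0ℚ; 1ℚ; mkℚ; _≤_; _+_; _*_)
  import Data.Rational.Properties as QP
  open import Data.Rational.Solver using (module +-*-Solver)
  import Data.Nat.Coprimality as Coprimality
  open import Algebra.Bundles using (CommutativeRing)
  open import Algebra.Properties.Semiring.Sum (CommutativeRing.semiring QP.+-*-commutativeRing)
    using (sum; sum-cong-≗; ∑-distrib-+; *-distribˡ-sum; sum-replicate-zero)
  open import Data.Fin as Fin using (Fin; _↑ˡ_; _↑ʳ_)
  open import Data.Fin.Subset using (Subset; ∣_∣; _∈_; _∉_)
  open import Data.Fin.Subset.Properties using (_∈?_)
  open import Data.Bool using (true; false)
  open import Data.Vec as V using (Vec; []; _∷_; _++_; lookup)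
  open import Data.List as L using (List; foldr) renaming ([] to nil; _∷_ to cons)
  open import Data.List.Relation.Unary.All using (All) renaming ([] to []ᵃ; _∷_ to _∷ᵃ_)
  open import Data.Product using (_×_; _,_; proj₁; proj₂)
  open import Relation.Binary.PropositionalEquality
  open import Relation.Nullary using (yes; no)
  open import Relation.Nullary.Negation using (contradiction)

  -- The embedding ℤ → ℚ in the form z / 1 in which InDilate states coordinates.
  ι : ℤ → ℚ
  ι z = z ℚ./ 1

  ι-mkℚ : ∀ z → ι z ≡ mkℚ z 0 (Coprimality.sym (Coprimality.1-coprimeTo ℤ.∣ z ∣))
  ι-mkℚ z = QP.↥p/↧p≡p (mkℚ z 0 (Coprimality.sym (Coprimality.1-coprimeTo ℤ.∣ z ∣)))

  ι-+ : ∀ z w → ι (z ℤ.+ w) ≡ ι z + ι w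
  ι-+ z w = sym (trans (cong₂ _+_ (ι-mkℚ z) (ι-mkℚ w)) (cong (ℚ._/ 1) (tidy z w)))
    where
    tidy : ∀ z w → z ℤ.* + 1 ℤ.+ w ℤ.* + 1 ≡ z ℤ.+ w
    tidy = solve-∀

  ι-≤⁻ : ∀ {z w} → ι z ≤ ι w → z ℤ.≤ w
  ι-≤⁻ {z} {w} le with subst₂ _≤_ (ι-mkℚ z) (ι-mkℚ w) le
  ... | ℚ.*≤* p = subst₂ ℤ._≤_ (ℤP.*-identityʳ z) (ℤP.*-identityʳ w) p

  ι-≤⁺ : ∀ {z w} → z ℤ.≤ w → ι z ≤ ι w
  ι-≤⁺ {z} {w} le = subst₂ _≤_ (sym (ι-mkℚ z)) (sym (ι-mkℚ w))
    (ℚ.*≤* (subst₂ ℤ._≤_ (sym (ℤP.*-identityʳ z)) (sym (ℤP.*-identityʳ w)) le))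

  ι-injective : ∀ {z w} → ι z ≡ ι w → z ≡ w
  ι-injective e = ℤP.≤-antisym (ι-≤⁻ (QP.≤-reflexive e)) (ι-≤⁻ (QP.≤-reflexive (sym e)))

  0≤ι : ∀ n → 0ℚ ≤ ι (+ n)
  0≤ι n = ι-≤⁺ {+ 0} {+ n} (ℤ.+≤+ z≤n)

  *-nonNeg : ∀ {p q} → 0ℚ ≤ p → 0ℚ ≤ q → 0ℚ ≤ p * q
  *-nonNeg {p} {q} 0≤p 0≤q = subst (_≤ p * q) (QP.*-zeroˡ q) (QP.*-monoʳ-≤-nonNeg q {{ℚ.nonNegative 0≤q}} 0≤p)

  *-monoˡ-≤ : ∀ {r p q} → 0ℚ ≤ r → p ≤ q → r * p ≤ r * q
  *-monoˡ-≤ {r} 0≤r = QP.*-monoˡ-≤-nonNeg r {{ℚ.nonNegative 0≤r}}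

  sum-++ : ∀ K M (f : Fin (K ℕ.+ M) → ℚ) → sum f ≡ sum (λ l → f (l ↑ˡ M)) + sum (λ j → f (K ↑ʳ j))
  sum-++ zero    M f = sym (QP.+-identityˡ _)
  sum-++ (suc K) M f = trans (cong (_+_ (f Fin.zero)) (sum-++ K M (λ i → f (Fin.suc i))))
                            (sym (QP.+-assoc (f Fin.zero) _ _))

  sum-ι-lookup : ∀ {n} (v : Vec ℕ n) → sum (λ i → ι (+ lookup v i)) ≡ ι (+ V.sum v)
  sum-ι-lookup []      = refl
  sum-ι-lookup (x ∷ v) = trans (cong (_+_ (ι (+ x))) (sum-ι-lookup v)) (sym (ι-+ (+ x) (+ V.sum v)))

  indicatorℤ : ∀ {n} → Subset n → Fin n → ℤ
  indicatorℤ B i with i ∈? B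
  ... | yes _ = + 1
  ... | no  _ = + 0

  indicatorℤ-∈ : ∀ {n} {B : Subset n} {i} → i ∈ B → indicatorℤ B i ≡ + 1
  indicatorℤ-∈ {B = B} {i} i∈B with i ∈? B
  ... | yes _   = refl
  ... | no  i∉B = contradiction i∈B i∉B

  indicatorℤ-∉ : ∀ {n} {B : Subset n} {i} → i ∉ B → indicatorℤ B i ≡ + 0
  indicatorℤ-∉ {B = B} {i} i∉B with i ∈? B
  ... | yes i∈B = contradiction i∈B i∉B
  ... | no  _   = refl

  indicator≡ι : ∀ {n} (B : Subset n) i → indicator B i ≡ ι (indicatorℤ B i)
  indicator≡ι B i with i ∈? B
  ... | yes _ = refl
  ... | no  _ = refl

  0≤indicator : ∀ {n} (B : Subset n) i → 0ℚ ≤ indicator B i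
  0≤indicator B i with i ∈? B
  ... | yes _ = ℚ.*≤* (ℤ.+≤+ z≤n)
  ... | no  _ = QP.≤-refl

  indicator≤1 : ∀ {n} (B : Subset n) i → indicator B i ≤ 1ℚ
  indicator≤1 B i with i ∈? B
  ... | yes _ = QP.≤-refl
  ... | no  _ = ℚ.*≤* (ℤ.+≤+ z≤n)

  indicator-suc : ∀ {n} x (B : Subset n) i → indicator (x ∷ B) (Fin.suc i) ≡ indicator B i
  indicator-suc x B i with i ∈? B
  ... | yes _ = refl
  ... | no  _ = refl

  sum-indicator : ∀ {n} (B : Subset n) → sum (indicator B) ≡ ι (+ ∣ B ∣)
  sum-indicator []      = refl
  sum-indicator (x ∷ B) = trans (cong (_+_ (indicator (x ∷ B) Fin.zero))
                                      (trans (sum-cong-≗ (indicator-suc x B)) (sum-indicator B)))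
                                (head x)
    where
    head : ∀ x → indicator (x ∷ B) Fin.zero + ι (+ ∣ B ∣) ≡ ι (+ ∣ x ∷ B ∣)
    head true  = sym (ι-+ (+ 1) (+ ∣ B ∣))
    head false = QP.+-identityˡ _

  module WeightedSums {N : ℕ} (P : Subset N → Set) where

    Admissible : ℚ × Subset N → Set
    Admissible p = (0ℚ ≤ proj₁ p) × P (proj₂ p)

    weighted : List (ℚ × Subset N) → (Subset N → ℚ) → ℚ
    weighted L φ = foldr (λ p acc → proj₁ p * φ (proj₂ p) + acc) 0ℚ L

    weighted-nonNeg : ∀ L φ → All Admissible L → (∀ B → P B → 0ℚ ≤ φ B) → 0ℚ ≤ weighted L φ
    weighted-nonNeg nil            φ _                  _   = QP.≤-refl
    weighted-nonNeg (cons (w , B) L) φ ((0≤w , pB) ∷ᵃ adm) 0≤φ =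
      QP.+-mono-≤ (*-nonNeg 0≤w (0≤φ B pB)) (weighted-nonNeg L φ adm 0≤φ)

    weighted-≤ : ∀ L φ c → All Admissible L → (∀ B → P B → φ B ≤ c) → weighted L φ ≤ c * weightSum L
    weighted-≤ nil              φ c _                  _   = QP.≤-reflexive (sym (QP.*-zeroʳ c))
    weighted-≤ (cons (w , B) L) φ c ((0≤w , pB) ∷ᵃ adm) φ≤c =
      QP.≤-trans (QP.+-mono-≤ (*-monoˡ-≤ 0≤w (φ≤c B pB)) (weighted-≤ L φ c adm φ≤c))
                 (QP.≤-reflexive (factor w c (weightSum L)))
      where
      open +-*-Solver
      factor : ∀ w c s → w * c + c * s ≡ c * (w + s)
      factor = solve 3 (λ w c s → w :* c :+ c :* s := c :* (w :+ s)) refl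

    weighted-const : ∀ L φ c → All Admissible L → (∀ B → P B → φ B ≡ c) → weighted L φ ≡ c * weightSum L
    weighted-const nil              φ c _                 _   = sym (QP.*-zeroʳ c)
    weighted-const (cons (w , B) L) φ c ((_ , pB) ∷ᵃ adm) φ≡c =
      trans (cong₂ _+_ (cong (w *_) (φ≡c B pB)) (weighted-const L φ c adm φ≡c)) (factor w c (weightSum L))
      where
      open +-*-Solver
      factor : ∀ w c s → w * c + c * s ≡ c * (w + s)
      factor = solve 3 (λ w c s → w :* c :+ c :* s := c :* (w :+ s)) refl

    sum-weighted : ∀ {n} L (φ : Fin n → Subset N → ℚ) → sum (λ i → weighted L (φ i)) ≡ weighted L (λ B → sum (λ i → φ i B))
    sum-weighted {n} nil              φ = sum-replicate-zero n
    sum-weighted     (cons (w , B) L) φ = trans (∑-distrib-+ (λ i → w * φ i B) (λ i → weighted L (φ i)))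
      (cong₂ _+_ (sym (*-distribˡ-sum w (λ i → φ i B))) (sum-weighted L φ))

    scale : ℚ → List (ℚ × Subset N) → List (ℚ × Subset N)
    scale c = L.map (λ p → (c * proj₁ p , proj₂ p))

    weightSum-scale : ∀ c L → weightSum (scale c L) ≡ c * weightSum L
    weightSum-scale c nil              = sym (QP.*-zeroʳ c)
    weightSum-scale c (cons (w , B) L) =
      trans (cong (_+_ (c * w)) (weightSum-scale c L)) (sym (QP.*-distribˡ-+ c w (weightSum L)))

    weighted-scale : ∀ c L φ → weighted (scale c L) φ ≡ c * weighted L φ
    weighted-scale c nil              φ = sym (QP.*-zeroʳ c)
    weighted-scale c (cons (w , B) L) φ = trans (cong₂ _+_ (QP.*-assoc c w (φ B)) (weighted-scale c L φ))
      (sym (QP.*-distribˡ-+ c (w * φ B) (weighted L φ)))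

    All-scale : ∀ {c} L → 0ℚ ≤ c → All Admissible L → All Admissible (scale c L)
    All-scale nil              0≤c []ᵃ                 = []ᵃ
    All-scale (cons (w , B) L) 0≤c ((0≤w , pB) ∷ᵃ adm) = (*-nonNeg 0≤c 0≤w , pB) ∷ᵃ All-scale L 0≤c adm

  InDilate-zero : ∀ {N} {IsB : Subset N → Set} {B} → IsB B → ∀ x → (∀ i → lookup x i ≡ + 0) → InDilate IsB 0 x
  InDilate-zero {B = B} isB x x≡0 =
    cons (1ℚ , B) nil , (ℚ.*≤* (ℤ.+≤+ z≤n) , isB) ∷ᵃ []ᵃ , QP.+-identityʳ 1ℚ ,
    λ i → trans (cong ι (x≡0 i)) (sym (QP.*-zeroˡ (WSum (cons (1ℚ , B) nil) i)))

  mixing-step : ∀ T w I W → (1ℚ + T) * w ≡ 1ℚ → (1ℚ + T) * (w * I + (1ℚ ℚ.- w) * W) ≡ T * W + I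
  mixing-step T w I W [1+T]w≡1 = begin
    (1ℚ + T) * (w * I + (1ℚ ℚ.- w) * W)                        ≡⟨ expand T w I W ⟩
    ((1ℚ + T) * w) * I + (1ℚ + T) * W ℚ.- ((1ℚ + T) * w) * W   ≡⟨ cong (λ u → u * I + (1ℚ + T) * W ℚ.- u * W) [1+T]w≡1 ⟩
    1ℚ * I + (1ℚ + T) * W ℚ.- 1ℚ * W                           ≡⟨ simplify T I W ⟩
    T * W + I                                                  ∎
    where
    open ≡-Reasoning
    open +-*-Solver
    expand : ∀ T w I W → (1ℚ + T) * (w * I + (1ℚ ℚ.- w) * W) ≡ ((1ℚ + T) * w) * I + (1ℚ + T) * W ℚ.- ((1ℚ + T) * w) * W
    expand = solve 4 (λ T w I W → (con 1ℚ :+ T) :* (w :* I :+ (con 1ℚ :- w) :* W) :=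
                        ((con 1ℚ :+ T) :* w) :* I :+ (con 1ℚ :+ T) :* W :- ((con 1ℚ :+ T) :* w) :* W) refl
    simplify : ∀ T I W → 1ℚ * I + (1ℚ + T) * W ℚ.- 1ℚ * W ≡ T * W + I
    simplify = solve 3 (λ T I W → con 1ℚ :* I :+ (con 1ℚ :+ T) :* W :- con 1ℚ :* W := T :* W :+ I) refl

  -- If x = x′ + e_B with x′ ∈ t·P, then x ∈ (t+1)·P via the weights 1/(t+1) on B and t/(t+1) on x′/t.
  InDilate-suc : ∀ {N} {IsB : Subset N → Set} {B t} {x x′ : Vec ℤ N} → IsB B → InDilate IsB t x′ →
    (∀ i → lookup x i ≡ lookup x′ i ℤ.+ indicatorℤ B i) → InDilate IsB (suc t) x
  InDilate-suc {N} {IsB} {B} {t} {x} {x′} isB (L , adm , ws≡1 , x′≡) x≡ =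
    cons (w , B) (scale (1ℚ ℚ.- w) L) , (0≤w , isB) ∷ᵃ All-scale L 0≤1-w adm , weights≡1 , coordinates
    where
    open WeightedSums IsB
    t+1 : ℚ
    t+1 = mkℚ (+ suc t) 0 (Coprimality.sym (Coprimality.1-coprimeTo (suc t)))
    w : ℚ
    w = ℚ.1/ t+1
    0≤w : 0ℚ ≤ w
    0≤w = ℚ.*≤* (ℤ.+≤+ z≤n)
    w≤1 : w ≤ 1ℚ
    w≤1 = ℚ.*≤* (ℤ.+≤+ (s≤s z≤n))
    0≤1-w : 0ℚ ≤ 1ℚ ℚ.- w
    0≤1-w = subst (_≤ 1ℚ ℚ.- w) (QP.+-inverseʳ w) (QP.+-monoˡ-≤ (ℚ.- w) w≤1)
    weights≡1 : weightSum (cons (w , B) (scale (1ℚ ℚ.- w) L)) ≡ 1ℚ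
    weights≡1 = trans (cong (_+_ w) (trans (weightSum-scale (1ℚ ℚ.- w) L) (cong ((1ℚ ℚ.- w) *_) ws≡1)))
                      (complement w)
      where
      open +-*-Solver
      complement : ∀ w → w + (1ℚ ℚ.- w) * 1ℚ ≡ 1ℚ
      complement = solve 1 (λ w → w :+ (con 1ℚ :- w) :* con 1ℚ := con 1ℚ) refl
    ι[t+1] : ι (+ suc t) ≡ 1ℚ + ι (+ t)
    ι[t+1] = ι-+ (+ 1) (+ t)
    [t+1]w≡1 : (1ℚ + ι (+ t)) * w ≡ 1ℚ
    [t+1]w≡1 = trans (cong (_* w) (trans (sym ι[t+1]) (ι-mkℚ (+ suc t)))) (QP.*-inverseʳ t+1)
    coordinates : ∀ i → ι (lookup x i) ≡ ι (+ suc t) * WSum (cons (w , B) (scale (1ℚ ℚ.- w) L)) i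
    coordinates i = sym (begin
      ι (+ suc t) * (w * indicator B i + weighted (scale (1ℚ ℚ.- w) L) (λ B′ → indicator B′ i))
        ≡⟨ cong₂ (λ p q → p * (w * indicator B i + q)) ι[t+1] (weighted-scale (1ℚ ℚ.- w) L (λ B′ → indicator B′ i)) ⟩
      (1ℚ + ι (+ t)) * (w * indicator B i + (1ℚ ℚ.- w) * WSum L i)
        ≡⟨ mixing-step (ι (+ t)) w (indicator B i) (WSum L i) [t+1]w≡1 ⟩
      ι (+ t) * WSum L i + indicator B i
        ≡⟨ cong₂ _+_ (sym (x′≡ i)) (indicator≡ι B i) ⟩
      ι (lookup x′ i) + ι (indicatorℤ B i)
        ≡⟨ ι-+ (lookup x′ i) (indicatorℤ B i) ⟨
      ι (lookup x′ i ℤ.+ indicatorℤ B i)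
        ≡⟨ cong ι (x≡ i) ⟨
      ι (lookup x i) ∎)
      where open ≡-Reasoning

  sum-const : ∀ n c → sum {n} (λ _ → c) ≡ ι (+ n) * c
  sum-const zero    c = sym (QP.*-zeroˡ c)
  sum-const (suc n) c = begin
    c + sum {n} (λ _ → c)   ≡⟨ cong (_+_ c) (sum-const n c) ⟩
    c + ι (+ n) * c         ≡⟨ cong (_+ ι (+ n) * c) (QP.*-identityˡ c) ⟨
    1ℚ * c + ι (+ n) * c    ≡⟨ QP.*-distribʳ-+ c 1ℚ (ι (+ n)) ⟨
    (1ℚ + ι (+ n)) * c      ≡⟨ cong (_* c) (ι-+ (+ 1) (+ n)) ⟨
    ι (+ suc n) * c         ∎
    where open ≡-Reasoning

  indicator-++ʳ : ∀ {m n} (p : Subset m) (q : Subset n) j → indicator (p ++ q) (m ↑ʳ j) ≡ indicator q j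
  indicator-++ʳ []      q j = refl
  indicator-++ʳ (x ∷ p) q j = trans (indicator-suc x (p ++ q) (_ ↑ʳ j)) (indicator-++ʳ p q j)

module LatticePoints (a b : ℕ) where

  open Dilates
  open SpanningTrees
  open Compositions
  open HStarSeries using (compositionCount; cumulativeCount)
  open import Data.Nat as ℕ using (ℕ; zero; suc; z≤n; s≤s)
  import Data.Nat.Properties as ℕP
  open import Data.Integer as ℤ using (ℤ; +_)
  import Data.Integer.Properties as ℤP
  open import Data.Integer.Tactic.RingSolver using (solve-∀)
  open import Data.Rational using (ℚ; 0ℚ; 1ℚ; _≤_; _+_; _*_)
  import Data.Rational.Properties as QP
  open import Algebra.Bundles using (CommutativeRing)
  open import Algebra.Properties.Semiring.Sum (CommutativeRing.semiring QP.+-*-commutativeRing)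
    using (sum; sum-cong-≗; ∑-distrib-+; *-distribˡ-sum)
  open import Algebra.Properties.Group QP.+-0-group using () renaming (∙-cancelʳ to +-cancelʳ)
  open import Data.Fin as Fin using (Fin; _↑ˡ_; _↑ʳ_)
  open import Data.Fin.Subset using (Subset)
  open import Data.Vec as V using (Vec; _++_; lookup; tabulate)
  import Data.Vec.Properties as VP
  open import Data.List using (List; length; cartesianProductWith) renaming (_++_ to _++ˡ_)
  import Data.List.Properties as LP
  open import Data.List.Membership.Propositional using (_∈_)
  open import Data.List.Membership.Propositional.Properties
    using (∈-++⁻; ∈-++⁺ˡ; ∈-++⁺ʳ; ∈-cartesianProductWith⁻; ∈-cartesianProductWith⁺)
  open import Data.List.Relation.Unary.Unique.Propositional using (Unique)
  import Data.List.Relation.Unary.Unique.Propositional.Properties as Unique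
  open import Data.List.Relation.Unary.All using (All)
  open import Data.Sum using (inj₁; inj₂)
  open import Data.Product using (_×_; _,_; proj₁; proj₂; Σ)
  open import Relation.Binary.PropositionalEquality
  open import Relation.Nullary using (yes; no; ¬_)

  K M : ℕ
  K = suc a
  M = suc b

  open TBases K M public
  open WeightedSums IsBasis

  point : ℕ → Vec ℕ K → Vec ℕ M → Vec ℤ (K ℕ.+ M)
  point t d y = V.map (λ dₗ → + t ℤ.- + dₗ) d ++ V.map +_ y

  PointForm : ℕ → ℕ → Vec ℤ (K ℕ.+ M) → Set
  PointForm u t x = Σ ℕ λ s → Σ (Vec ℕ K) λ d → Σ (Vec ℕ M) λ y →
    s ℕ.≤ u × V.sum d ≡ s × V.sum y ≡ s × x ≡ point t d y

  lookup-point-path : ∀ t d y l → lookup (point t d y) (l ↑ˡ M) ≡ + t ℤ.- + lookup d l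
  lookup-point-path t d y l = trans (VP.lookup-++ˡ (V.map _ d) (V.map +_ y) l) (VP.lookup-map l _ d)

  lookup-point-parallel : ∀ t d y j → lookup (point t d y) (K ↑ʳ j) ≡ + lookup y j
  lookup-point-parallel t d y j = trans (VP.lookup-++ʳ (V.map _ d) (V.map +_ y) j) (VP.lookup-map j +_ y)

  basis-size : ∀ B → IsBasis B → sum (indicator B) ≡ ι (+ K)
  basis-size B (_ , size) = trans (sum-indicator B) (cong (λ n → ι (+ n)) (ℕP.suc-injective size))

  basis-parallel : ∀ B → IsBasis B → sum (λ j → indicator B (K ↑ʳ j)) ≤ 1ℚ
  basis-parallel B isB with V.splitAt K B
  ... | Sp , Sq , refl = QP.≤-trans
    (QP.≤-reflexive (trans (sum-cong-≗ (indicator-++ʳ Sp Sq)) (sum-indicator Sq)))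
    (ι-≤⁺ (ℤ.+≤+ (atMostOneParallel Sp Sq isB)))

  WSum≤1 : ∀ {L} → All Admissible L → weightSum L ≡ 1ℚ → ∀ i → WSum L i ≤ 1ℚ
  WSum≤1 {L} admissible weights≡1 i =
    QP.≤-trans (weighted-≤ L _ 1ℚ admissible (λ B _ → indicator≤1 B i))
               (QP.≤-reflexive (trans (cong (1ℚ *_) weights≡1) (QP.*-identityˡ 1ℚ)))

  sum-dilate : ∀ {t x L} → (∀ i → ι (lookup x i) ≡ ι (+ t) * WSum L i) → ∀ {n} (f : Fin n → Fin (K ℕ.+ M)) →
    sum (λ i → ι (lookup x (f i))) ≡ ι (+ t) * weighted L (λ B → sum (λ i → indicator B (f i)))
  sum-dilate {t} {x} {L} x≡ f = trans (sum-cong-≗ (λ i → x≡ (f i)))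
    (trans (sym (*-distribˡ-sum (ι (+ t)) (λ i → WSum L (f i))))
           (cong (ι (+ t) *_) (sum-weighted L (λ i B → indicator B (f i)))))

  dilate-bounds : ∀ t x → InDilate IsBasis t x → ∀ i → + 0 ℤ.≤ lookup x i × lookup x i ℤ.≤ + t
  dilate-bounds t x (L , admissible , weights≡1 , x≡) i =
    ι-≤⁻ (subst (0ℚ ≤_) (sym (x≡ i)) (*-nonNeg (0≤ι t) (weighted-nonNeg L _ admissible (λ B _ → 0≤indicator B i)))) ,
    ι-≤⁻ (subst (_≤ ι (+ t)) (sym (x≡ i))
           (QP.≤-trans (*-monoˡ-≤ (0≤ι t) (WSum≤1 admissible weights≡1 i)) (QP.≤-reflexive (QP.*-identityʳ (ι (+ t))))))

  dilate-total : ∀ t x → InDilate IsBasis t x → sum (λ i → ι (lookup x i)) ≡ ι (+ K) * ι (+ t)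
  dilate-total t x (L , admissible , weights≡1 , x≡) = begin
    sum (λ i → ι (lookup x i))                      ≡⟨ sum-dilate {t} {x} {L} x≡ (λ i → i) ⟩
    T * weighted L (λ B → sum (indicator B))        ≡⟨ cong (T *_) (weighted-const L _ (ι (+ K)) admissible basis-size) ⟩
    T * (ι (+ K) * weightSum L)                     ≡⟨ cong (λ w → T * (ι (+ K) * w)) weights≡1 ⟩
    T * (ι (+ K) * 1ℚ)                              ≡⟨ cong (T *_) (QP.*-identityʳ (ι (+ K))) ⟩
    T * ι (+ K)                                     ≡⟨ QP.*-comm T (ι (+ K)) ⟩
    ι (+ K) * T                                     ∎
    where
    open ≡-Reasoning
    T : ℚ
    T = ι (+ t)

  dilate-parallel : ∀ t x → InDilate IsBasis t x → sum (λ j → ι (lookup x (K ↑ʳ j))) ≤ ι (+ t)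
  dilate-parallel t x (L , admissible , weights≡1 , x≡) = begin
    sum (λ j → ι (lookup x (K ↑ʳ j)))                      ≡⟨ sum-dilate {t} {x} {L} x≡ (K ↑ʳ_) ⟩
    T * weighted L (λ B → sum (λ j → indicator B (K ↑ʳ j))) ≤⟨ *-monoˡ-≤ (0≤ι t) (weighted-≤ L _ 1ℚ admissible basis-parallel) ⟩
    T * (1ℚ * weightSum L)                                 ≡⟨ cong (λ w → T * (1ℚ * w)) weights≡1 ⟩
    T * (1ℚ * 1ℚ)                                          ≡⟨ QP.*-identityʳ T ⟩
    T                                                      ∎
    where
    open QP.≤-Reasoning
    T : ℚ
    T = ι (+ t)

  pathDeficits : ℕ → Vec ℤ (K ℕ.+ M) → Vec ℕ K
  pathDeficits t x = tabulate (λ l → ℤ.∣ + t ℤ.- lookup x (l ↑ˡ M) ∣)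

  parallelPart : Vec ℤ (K ℕ.+ M) → Vec ℕ M
  parallelPart x = tabulate (λ j → ℤ.∣ lookup x (K ↑ʳ j) ∣)

  module _ (t : ℕ) (x : Vec ℤ (K ℕ.+ M)) (inP : InDilate IsBasis t x) where

    +pathDeficits : ∀ l → + lookup (pathDeficits t x) l ≡ + t ℤ.- lookup x (l ↑ˡ M)
    +pathDeficits l = trans (cong +_ (VP.lookup∘tabulate (λ l → ℤ.∣ + t ℤ.- lookup x (l ↑ˡ M) ∣) l))
                            (ℤP.0≤i⇒+∣i∣≡i (ℤP.i≤j⇒0≤j-i (proj₂ (dilate-bounds t x inP (l ↑ˡ M)))))

    +parallelPart : ∀ j → + lookup (parallelPart x) j ≡ lookup x (K ↑ʳ j)
    +parallelPart j = trans (cong +_ (VP.lookup∘tabulate (λ j → ℤ.∣ lookup x (K ↑ʳ j) ∣) j))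
                            (ℤP.0≤i⇒+∣i∣≡i (proj₁ (dilate-bounds t x inP (K ↑ʳ j))))

    ι-sum-parallelPart : ι (+ V.sum (parallelPart x)) ≡ sum (λ j → ι (lookup x (K ↑ʳ j)))
    ι-sum-parallelPart = trans (sym (sum-ι-lookup (parallelPart x))) (sum-cong-≗ (λ j → cong ι (+parallelPart j)))

    sum-parallelPart≤t : V.sum (parallelPart x) ℕ.≤ t
    sum-parallelPart≤t = ℤP.drop‿+≤+ (ι-≤⁻ (subst (_≤ ι (+ t)) (sym ι-sum-parallelPart) (dilate-parallel t x inP)))

    -- Both sides, plus the path coordinates of x, give Σ x = K t.
    sum-pathDeficits : V.sum (pathDeficits t x) ≡ V.sum (parallelPart x)
    sum-pathDeficits = ℤP.+-injective (ι-injective (+-cancelʳ Σpath _ _ (begin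
      ι (+ V.sum d) + Σpath                              ≡⟨ cong (_+ Σpath) (sum-ι-lookup d) ⟨
      sum (λ l → ι (+ lookup d l)) + Σpath               ≡⟨ ∑-distrib-+ (λ l → ι (+ lookup d l)) (λ l → ι (X (l ↑ˡ M))) ⟨
      sum (λ l → ι (+ lookup d l) + ι (X (l ↑ˡ M)))      ≡⟨ sum-cong-≗ complement ⟩
      sum {K} (λ _ → ι (+ t))                            ≡⟨ sum-const K (ι (+ t)) ⟩
      ι (+ K) * ι (+ t)                                  ≡⟨ dilate-total t x inP ⟨
      sum (λ i → ι (X i))                                ≡⟨ sum-++ K M (λ i → ι (X i)) ⟩
      Σpath + sum (λ j → ι (X (K ↑ʳ j)))                 ≡⟨ cong (_+_ Σpath) ι-sum-parallelPart ⟨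
      Σpath + ι (+ V.sum (parallelPart x))               ≡⟨ QP.+-comm Σpath _ ⟩
      ι (+ V.sum (parallelPart x)) + Σpath               ∎)))
      where
      open ≡-Reasoning
      X : Fin (K ℕ.+ M) → ℤ
      X = lookup x
      d : Vec ℕ K
      d = pathDeficits t x
      Σpath : ℚ
      Σpath = sum (λ l → ι (X (l ↑ˡ M)))
      cancel : ∀ t z → (t ℤ.- z) ℤ.+ z ≡ t
      cancel = solve-∀
      complement : ∀ l → ι (+ lookup d l) + ι (X (l ↑ˡ M)) ≡ ι (+ t)
      complement l = trans (sym (ι-+ (+ lookup d l) (X (l ↑ˡ M))))
                           (cong ι (trans (cong (ℤ._+ X (l ↑ˡ M)) (+pathDeficits l)) (cancel (+ t) (X (l ↑ˡ M)))))

    x≡point : x ≡ point t (pathDeficits t x) (parallelPart x)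
    x≡point = lookup-ext coordinate
      where
      involutive : ∀ t z → t ℤ.- (t ℤ.- z) ≡ z
      involutive = solve-∀
      coordinate : ∀ i → lookup x i ≡ lookup (point t (pathDeficits t x) (parallelPart x)) i
      coordinate i with edgeView i
      ... | path l = sym (trans (lookup-point-path t (pathDeficits t x) (parallelPart x) l)
                                (trans (cong (ℤ._-_ (+ t)) (+pathDeficits l)) (involutive (+ t) (lookup x (l ↑ˡ M)))))
      ... | parallel j = sym (trans (lookup-point-parallel t (pathDeficits t x) (parallelPart x) j) (+parallelPart j))

  InDilate⇒PointForm : ∀ t x → InDilate IsBasis t x → PointForm t t x
  InDilate⇒PointForm t x inP = V.sum (parallelPart x) , pathDeficits t x , parallelPart x ,
    sum-parallelPart≤t t x inP , sum-pathDeficits t x inP , refl , x≡point t x inP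

  Peeled : ℕ → Vec ℤ (K ℕ.+ M) → Set
  Peeled t x = Σ (Subset (K ℕ.+ M)) λ B → IsBasis B × Σ (Vec ℤ (K ℕ.+ M)) λ x′ →
    PointForm t t x′ × (∀ i → lookup x i ≡ lookup x′ i ℤ.+ indicatorℤ B i)

  private
    raise : ∀ t z → + suc t ℤ.- z ≡ (+ t ℤ.- z) ℤ.+ + 1
    raise t z = shift (+ t) z
      where
      shift : ∀ t z → (+ 1 ℤ.+ t) ℤ.- z ≡ (t ℤ.- z) ℤ.+ + 1
      shift = solve-∀
    lower : ∀ t c → + suc t ℤ.- + suc c ≡ (+ t ℤ.- + c) ℤ.+ + 0
    lower t c = shift (+ t) (+ c)
      where
      shift : ∀ t c → (+ 1 ℤ.+ t) ℤ.- (+ 1 ℤ.+ c) ≡ (t ℤ.- c) ℤ.+ + 0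
      shift = solve-∀

  peel-by-coordinates : ∀ t {d d′ y y′} B →
    (∀ l → + suc t ℤ.- + lookup d l ≡ (+ t ℤ.- + lookup d′ l) ℤ.+ indicatorℤ B (l ↑ˡ M)) →
    (∀ j → + lookup y j ≡ + lookup y′ j ℤ.+ indicatorℤ B (K ↑ʳ j)) →
    ∀ i → lookup (point (suc t) d y) i ≡ lookup (point t d′ y′) i ℤ.+ indicatorℤ B i
  peel-by-coordinates t {d} {d′} {y} {y′} B onPath onParallel i with edgeView i
  ... | path l = trans (lookup-point-path (suc t) d y l)
                       (trans (onPath l) (cong (ℤ._+ indicatorℤ B (l ↑ˡ M)) (sym (lookup-point-path t d′ y′ l))))
  ... | parallel j = trans (lookup-point-parallel (suc t) d y j)
                       (trans (onParallel j) (cong (ℤ._+ indicatorℤ B (K ↑ʳ j)) (sym (lookup-point-parallel t d′ y′ j))))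

  peel-path : ∀ t d y i → lookup (point (suc t) d y) i ≡ lookup (point t d y) i ℤ.+ indicatorℤ pathBasis i
  peel-path t d y = peel-by-coordinates t {d} {d} {y} {y} pathBasis
    (λ l → trans (raise t (+ lookup d l)) (cong (ℤ._+_ (+ t ℤ.- + lookup d l)) (sym (indicatorℤ-∈ (pathBasis-path l)))))
    (λ j → trans (sym (ℤP.+-identityʳ (+ lookup y j))) (cong (ℤ._+_ (+ lookup y j)) (sym (indicatorℤ-∉ (pathBasis-parallel j)))))

  peel-exchange : ∀ t d y l₀ j₀ {c c′} → lookup d l₀ ≡ suc c → lookup y j₀ ≡ suc c′ → ∀ i →
    lookup (point (suc t) d y) i
      ≡ lookup (point t (decrement d l₀) (decrement y j₀)) i ℤ.+ indicatorℤ (exchangeBasis l₀ j₀) i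
  peel-exchange t d y l₀ j₀ {c} {c′} d≡ y≡ =
    peel-by-coordinates t {d} {decrement d l₀} {y} {decrement y j₀} (exchangeBasis l₀ j₀) onPath onParallel
    where
    onPath : ∀ l → + suc t ℤ.- + lookup d l
                   ≡ (+ t ℤ.- + lookup (decrement d l₀) l) ℤ.+ indicatorℤ (exchangeBasis l₀ j₀) (l ↑ˡ M)
    onPath l with l Fin.≟ l₀
    ... | yes refl = begin
      + suc t ℤ.- + lookup d l₀                     ≡⟨ cong (λ z → + suc t ℤ.- + z) d≡ ⟩
      + suc t ℤ.- + suc c                           ≡⟨ lower t c ⟩
      (+ t ℤ.- + c) ℤ.+ + 0                         ≡⟨ cong₂ (λ z w → (+ t ℤ.- + z) ℤ.+ w)
                                                       (trans (VP.lookup∘updateAt l₀ d) (cong ℕ.pred d≡))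
                                                       (indicatorℤ-∉ (exchangeBasis-removed l₀ j₀)) ⟨
      (+ t ℤ.- + lookup (decrement d l₀) l₀) ℤ.+ indicatorℤ (exchangeBasis l₀ j₀) (l₀ ↑ˡ M) ∎
      where open ≡-Reasoning
    ... | no l≢l₀ = trans (raise t (+ lookup d l))
      (cong₂ (λ z w → (+ t ℤ.- + z) ℤ.+ w) (sym (VP.lookup∘updateAt′ l l₀ l≢l₀ d))
                                          (sym (indicatorℤ-∈ (exchangeBasis-path {j = j₀} l l≢l₀))))
    onParallel : ∀ j → + lookup y j ≡ + lookup (decrement y j₀) j ℤ.+ indicatorℤ (exchangeBasis l₀ j₀) (K ↑ʳ j)
    onParallel j with j Fin.≟ j₀
    ... | yes refl = begin
      + lookup y j₀                                 ≡⟨ cong +_ (trans y≡ (ℕP.+-comm 1 c′)) ⟩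
      + c′ ℤ.+ + 1                                  ≡⟨ cong₂ (λ z w → + z ℤ.+ w)
                                                       (trans (VP.lookup∘updateAt j₀ y) (cong ℕ.pred y≡))
                                                       (indicatorℤ-∈ (exchangeBasis-added l₀ j₀)) ⟨
      + lookup (decrement y j₀) j₀ ℤ.+ indicatorℤ (exchangeBasis l₀ j₀) (K ↑ʳ j₀) ∎
      where open ≡-Reasoning
    ... | no j≢j₀ = trans (sym (ℤP.+-identityʳ (+ lookup y j)))
      (cong₂ (λ z w → + z ℤ.+ w) (sym (VP.lookup∘updateAt′ j j₀ j≢j₀ y))
                                (sym (indicatorℤ-∉ (exchangeBasis-parallel {l₀} j j≢j₀))))

  peel : ∀ t x → PointForm (suc t) (suc t) x → Peeled t x
  peel t x (zero , d , y , _ , sum-d , sum-y , refl) =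
    pathBasis , pathBasis-isBasis , point t d y , (0 , d , y , z≤n , sum-d , sum-y , refl) , peel-path t d y
  peel t x (suc s , d , y , s<t , sum-d , sum-y , refl) with positive-entry d sum-d | positive-entry y sum-y
  ... | l₀ , c , d≡ | j₀ , c′ , y≡ =
    exchangeBasis l₀ j₀ , exchangeBasis-isBasis l₀ j₀ , point t (decrement d l₀) (decrement y j₀) ,
    (s , decrement d l₀ , decrement y j₀ , ℕP.≤-pred s<t ,
       ℕP.suc-injective (trans (sum-decrement d l₀ d≡) sum-d) ,
       ℕP.suc-injective (trans (sum-decrement y j₀ y≡) sum-y) , refl) ,
    peel-exchange t d y l₀ j₀ d≡ y≡

  PointForm⇒InDilate : ∀ t x → PointForm t t x → InDilate IsBasis t x
  PointForm⇒InDilate zero x (zero , d , y , _ , sum-d , sum-y , refl) =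
    InDilate-zero pathBasis-isBasis (point 0 d y) origin
    where
    origin : ∀ i → lookup (point 0 d y) i ≡ + 0
    origin i with edgeView i
    ... | path l     = trans (lookup-point-path 0 d y l) (cong (λ z → + 0 ℤ.- + z) (zero-entries d sum-d l))
    ... | parallel j = trans (lookup-point-parallel 0 d y j) (cong +_ (zero-entries y sum-y j))
  PointForm⇒InDilate (suc t) x pf with peel t x pf
  ... | B , isB , x′ , pf′ , x≡ = InDilate-suc {B = B} {t} {x} {x′} isB (PointForm⇒InDilate t x′ pf′) x≡

  point-injective : ∀ t {d d′ y y′} → point t d y ≡ point t d′ y′ → d ≡ d′ × y ≡ y′
  point-injective t {d} {d′} {y} {y′} eq =
    map-injective (λ e → ℤP.+-injective (subtract-injective e)) (VP.++-injectiveˡ (V.map _ d) (V.map _ d′) eq) ,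
    map-injective ℤP.+-injective (VP.++-injectiveʳ (V.map _ d) (V.map _ d′) eq)
    where
    involutive : ∀ t z → t ℤ.- (t ℤ.- z) ≡ z
    involutive = solve-∀
    subtract-injective : ∀ {z w} → + t ℤ.- z ≡ + t ℤ.- w → z ≡ w
    subtract-injective {z} {w} e =
      trans (sym (involutive (+ t) z)) (trans (cong (ℤ._-_ (+ t)) e) (involutive (+ t) w))

  layer : ℕ → ℕ → List (Vec ℤ (K ℕ.+ M))
  layer t s = cartesianProductWith (point t) (compositions a s) (compositions b s)

  pointsUpTo : ℕ → ℕ → List (Vec ℤ (K ℕ.+ M))
  pointsUpTo t zero    = layer t 0
  pointsUpTo t (suc u) = pointsUpTo t u ++ˡ layer t (suc u)

  length-layer : ∀ t s → length (layer t s) ≡ compositionCount a s ℕ.* compositionCount b s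
  length-layer t s = trans (length-cartesianProductWith (point t) (compositions a s) (compositions b s))
                           (cong₂ ℕ._*_ (length-compositions a s) (length-compositions b s))

  length-pointsUpTo : ∀ t u → length (pointsUpTo t u) ≡ cumulativeCount a b u
  length-pointsUpTo t zero    = length-layer t 0
  length-pointsUpTo t (suc u) =
    trans (LP.length-++ (pointsUpTo t u)) (cong₂ ℕ._+_ (length-pointsUpTo t u) (length-layer t (suc u)))

  ∈-layer⁻ : ∀ t s x → x ∈ layer t s →
    Σ (Vec ℕ K) λ d → Σ (Vec ℕ M) λ y → V.sum d ≡ s × V.sum y ≡ s × x ≡ point t d y
  ∈-layer⁻ t s x x∈ with ∈-cartesianProductWith⁻ (point t) (compositions a s) (compositions b s) x∈
  ... | d , y , d∈ , y∈ , x≡ = d , y , ∈-compositions⁻ a s d d∈ , ∈-compositions⁻ b s y y∈ , x≡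

  ∈-pointsUpTo⁻ : ∀ t u x → x ∈ pointsUpTo t u → PointForm u t x
  ∈-pointsUpTo⁻ t zero    x x∈ with ∈-layer⁻ t 0 x x∈
  ... | d , y , sum-d , sum-y , x≡ = 0 , d , y , z≤n , sum-d , sum-y , x≡
  ∈-pointsUpTo⁻ t (suc u) x x∈ with ∈-++⁻ (pointsUpTo t u) x∈
  ... | inj₁ x∈ᵤ with ∈-pointsUpTo⁻ t u x x∈ᵤ
  ...   | s , d , y , s≤u , sum-d , sum-y , x≡ = s , d , y , ℕP.m≤n⇒m≤1+n s≤u , sum-d , sum-y , x≡
  ∈-pointsUpTo⁻ t (suc u) x x∈ | inj₂ x∈ₗ with ∈-layer⁻ t (suc u) x x∈ₗ
  ...   | d , y , sum-d , sum-y , x≡ = suc u , d , y , ℕP.≤-refl , sum-d , sum-y , x≡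

  ∈-pointsUpTo⁺ : ∀ t u x → PointForm u t x → x ∈ pointsUpTo t u
  ∈-pointsUpTo⁺ t zero    x (.0 , d , y , z≤n , sum-d , sum-y , refl) =
    ∈-cartesianProductWith⁺ (point t) (∈-compositions⁺ a 0 d sum-d) (∈-compositions⁺ b 0 y sum-y)
  ∈-pointsUpTo⁺ t (suc u) x (s , d , y , s≤1+u , sum-d , sum-y , refl) with ℕP.m≤n⇒m<n∨m≡n s≤1+u
  ... | inj₁ s<1+u = ∈-++⁺ˡ (∈-pointsUpTo⁺ t u _ (s , d , y , ℕP.≤-pred s<1+u , sum-d , sum-y , refl))
  ... | inj₂ refl  = ∈-++⁺ʳ (pointsUpTo t u)
    (∈-cartesianProductWith⁺ (point t) (∈-compositions⁺ a (suc u) d sum-d) (∈-compositions⁺ b (suc u) y sum-y))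

  layer-unique : ∀ t s → Unique (layer t s)
  layer-unique t s = Unique.cartesianProductWith⁺ (point t) (point-injective t)
    (compositions-unique a s) (compositions-unique b s)

  pointsUpTo-unique : ∀ t u → Unique (pointsUpTo t u)
  pointsUpTo-unique t zero    = layer-unique t 0
  pointsUpTo-unique t (suc u) = Unique.++⁺ (pointsUpTo-unique t u) (layer-unique t (suc u)) disjoint
    where
    disjoint : ∀ {x} → ¬ (x ∈ pointsUpTo t u × x ∈ layer t (suc u))
    disjoint {x} (x∈ᵤ , x∈ₗ) with ∈-pointsUpTo⁻ t u x x∈ᵤ | ∈-layer⁻ t (suc u) x x∈ₗ
    ... | s , d , y , s≤u , _ , sum-y , x≡ | d′ , y′ , _ , sum-y′ , x≡′ =
      ℕP.<-irrefl (trans (sym sum-y) (trans (cong V.sum y≡y′) sum-y′)) (s≤s s≤u)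
      where
      y≡y′ : y ≡ y′
      y≡y′ = proj₂ (point-injective t {d} {d′} {y} {y′} (trans (sym x≡) x≡′))

open import Data.Nat as ℕ using (ℕ; zero; suc; _≤_; _∸_; z≤n; s≤s)
import Data.Nat.Properties as ℕP
open import Data.Nat.Combinatorics using (_C_; nCk≡nC[n∸k]; nCn≡1; nCk+nC[k+1]≡[n+1]C[k+1])
open import Data.Nat.Combinatorics.Specification using (k>n⇒nCk≡0)
open import Data.Integer as ℤ using (+_)
import Data.Integer.Properties as ℤP
open import Data.Fin.Subset using (Subset)
open import Data.List.Membership.Propositional using (_∈_)
open import Data.List.Membership.Propositional.Properties.WithK using (unique∧set⇒bag)
open import Data.List.Relation.Binary.BagAndSetEquality using (∼bag⇒↭)
open import Data.List.Relation.Binary.Permutation.Propositional.Properties using (↭-length)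
open import Data.Product using (_×_; _,_)
open import Function.Bundles using (_⇔_; mk⇔)
open import Function.Construct.Composition using (_⇔-∘_)
open import Function.Construct.Symmetry using (⇔-sym)
open import Relation.Binary.PropositionalEquality
open ConvolutionAlgebra using (⊛-congʳ)
open HStarSeries
open LogConcavity

binomial≡C : ∀ n k → binomial n k ≡ n C k
binomial≡C n       zero    = sym (trans (nCk≡nC[n∸k] {k = 0} {n = n} z≤n) (nCn≡1 n))
binomial≡C zero    (suc k) = sym (k>n⇒nCk≡0 {0} {suc k} (s≤s z≤n))
binomial≡C (suc n) (suc k) = trans (cong₂ ℕ._+_ (binomial≡C n k) (binomial≡C n (suc k))) (nCk+nC[k+1]≡[n+1]C[k+1] n k)

LogConcave-resp : ∀ {f g : ℕ → ℕ} → (∀ j → f j ≡ g j) → LogConcave f → LogConcave g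
LogConcave-resp f≡g lc j =
  subst₂ _≤_ (cong₂ ℕ._*_ (f≡g j) (f≡g (2 ℕ.+ j))) (cong₂ ℕ._*_ (f≡g (suc j)) (f≡g (suc j))) (lc j)

Unimodal-resp : ∀ {f g : ℕ → ℕ} → (∀ j → f j ≡ g j) → Unimodal f → Unimodal g
Unimodal-resp f≡g (m , up , down) =
  m , (λ i j i≤j j≤m → subst₂ _≤_ (f≡g i) (f≡g j) (up i j i≤j j≤m)) ,
      (λ i j m≤i i≤j → subst₂ _≤_ (f≡g j) (f≡g i) (down i j m≤i i≤j))

LatticeCount-unique : ∀ {n} {IsB : Subset n → Set} {t c c′} → LatticeCount IsB t c → LatticeCount IsB t c′ → c ≡ c′
LatticeCount-unique (pts , unique , pts⇔ , length≡c) (pts′ , unique′ , pts′⇔ , length≡c′) =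
  trans (sym length≡c) (trans (↭-length (∼bag⇒↭ (unique∧set⇒bag unique unique′ same-members))) length≡c′)
  where
  same-members : ∀ {x} → (x ∈ pts) ⇔ (x ∈ pts′)
  same-members {x} = ⇔-sym (pts′⇔ x) ⇔-∘ pts⇔ x

module _ (a b : ℕ) where

  open LatticePoints a b

  latticeCount : ∀ t → LatticeCount IsBasis t (cumulativeCount a b t)
  latticeCount t = pointsUpTo t t , pointsUpTo-unique t t ,
    (λ x → mk⇔ (λ x∈ → PointForm⇒InDilate t x (∈-pointsUpTo⁻ t t x x∈))
               (λ x∈tP → ∈-pointsUpTo⁺ t t x (InDilate⇒PointForm t x x∈tP))) ,
    length-pointsUpTo t t

  hT≡binomials : ∀ j → binomial a j ℕ.* binomial b j ≡ hT (suc a) (suc a ℕ.+ suc b) j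
  hT≡binomials j = cong₂ ℕ._*_ (binomial≡C a j)
    (trans (binomial≡C b j) (cong (λ m → (m ∸ 1) C j) (sym (ℕP.m+n∸m≡n (suc a) (suc b)))))

  hStar-T : ∀ i → IsEhrhart (IsBasisT (suc a) (suc a ℕ.+ suc b)) i →
    IsHStar (a ℕ.+ suc b) i (hT (suc a) (suc a ℕ.+ suc b)) ×
    LogConcave (hT (suc a) (suc a ℕ.+ suc b)) × Unimodal (hT (suc a) (suc a ℕ.+ suc b))
  hStar-T i ehrhart = hstar , LogConcave-resp hT≡binomials logConcave , Unimodal-resp hT≡binomials unimodal
    where
    h : ℕ → ℕ
    h j = binomial a j ℕ.* binomial b j
    hstar : IsHStar (a ℕ.+ suc b) i (hT (suc a) (suc a ℕ.+ suc b))
    hstar m = begin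
      (oneMinusXPow (suc a ℕ.+ suc b) ⊛ (λ t → + i t)) m
        ≡⟨ ⊛-congʳ (oneMinusXPow (suc a ℕ.+ suc b)) (λ t → cong +_ (LatticeCount-unique {t = t} (ehrhart t) (latticeCount t))) m ⟩
      (oneMinusXPow (suc a ℕ.+ suc b) ⊛ (λ t → + cumulativeCount a b t)) m
        ≡⟨ oneMinusXPow-⊛-cumulativeCount a b m ⟩
      + binomial a m ℤ.* + binomial b m
        ≡⟨ ℤP.pos-* (binomial a m) (binomial b m) ⟨
      + h m
        ≡⟨ cong +_ (hT≡binomials m) ⟩
      + hT (suc a) (suc a ℕ.+ suc b) m ∎
      where open ≡-Reasoning
    logConcave : LogConcave h
    logConcave = LogConcave-* {binomial a} {binomial b} (binomial-logConcave a) (binomial-logConcave b)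
    unimodal : Unimodal h
    unimodal = logConcave⇒unimodal logConcave
      (NoInternalZeros-* {binomial a} {binomial b} (binomial-noInternalZeros a) (binomial-noInternalZeros b)) a
      (subst (_≤ h a) (sym (cong (ℕ._* binomial b (suc a)) (binomial-vanishesAbove a))) z≤n)

corollary4p1 : (k n : ℕ) → 1 ≤ k → k ≤ n ∸ 1 → (i : ℕ → ℕ) →
    IsEhrhart (IsBasisT k n) i →
    IsHStar (n ∸ 1) i (hT k n) × LogConcave (hT k n) × Unimodal (hT k n)
corollary4p1 zero    _        ()  _    _
corollary4p1 (suc a) zero     _   ()   _
corollary4p1 (suc a) (suc n′) _   k≤n′ i =
  subst (λ n → IsEhrhart (IsBasisT (suc a) n) i →
               IsHStar (n ∸ 1) i (hT (suc a) n) × LogConcave (hT (suc a) n) × Unimodal (hT (suc a) n))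
        n≡ (hStar-T a b i)
  where
  b : ℕ
  b = n′ ∸ suc a
  n≡ : suc a ℕ.+ suc b ≡ suc n′
  n≡ = cong suc (trans (ℕP.+-suc a b) (ℕP.m+[n∸m]≡n k≤n′))
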